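{- Let $n\ge 6$ and let $G_n$ be a connected bicyclic graph of order $n$ (a connected simple graph with $n$ vertices and $n+1$ edges) having at least one pendant edge, i.e., minimum degree $\delta(G_n)=1$. Then $Sz^*(G_n)<Sz^*(B_n)$.
   Context: All graphs are finite, simple and undirected. For a connected graph $G=(V,E)$ and an edge $e=uv\in E$, let $N_u(e)=\{w\in V: d(u,w)<d(v,w)\}$, $N_v(e)=\{w\in V: d(v,w)<d(u,w)\}$, $N_0(e)=\{w\in V: d(u,w)=d(v,w)\}$, where $d$ is the graph distance, and let $n_u(e),n_v(e),n_0(e)$ be their cardinalities. The revised Szeged index is $Sz^*(G)=\sum_{e=uv\in E}\left(n_u(e)+\frac{n_0(e)}{2}\right)\left(n_v(e)+\frac{n_0(e)}{2}\right)$. $B_n$ denotes the graph obtained from the cycle $C_{n-1}$ by duplicating a single vertex, i.e., adding a new vertex adjacent exactly to the two neighbours of a chosen vertex of $C_{n-1}$. -}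

module Defs where

open import Data.Nat using (ℕ; zero; suc; _+_; _*_; _∸_; _<ᵇ_; _≡ᵇ_)
open import Data.Bool using (Bool; true; false; _∧_; _∨_; not; if_then_else_)
open import Data.Bool.Properties using (∨-comm)
open import Relation.Binary.PropositionalEquality using (refl; cong; cong₂)
open import Data.Fin using (Fin; toℕ)
open import Data.List using (List; []; _∷_; allFin; filter; length; map; foldr; concatMap)
open import Data.Bool.ListAction using (any)
open import Data.Product using (_×_; _,_; ∃)
open import Relation.Binary.PropositionalEquality using (_≡_)
open import Relation.Nullary.Decidable using (does)
open import Data.Bool.Properties using (T?)
open import Data.Integer using (+_)
open import Data.Rational using (ℚ; _/_) renaming (_+_ to _+ℚ_; _*_ to _*ℚ_; 0ℚ to 0ℚ)

record Graph (n : ℕ) : Set where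
  field
    adj     : Fin n → Fin n → Bool
    sym     : ∀ u v → adj u v ≡ adj v u
    irrefl  : ∀ u → adj u u ≡ false
open Graph public

_==_ : ∀ {n} → Fin n → Fin n → Bool
u == v = toℕ u ≡ᵇ toℕ v

reach : ∀ {n} → Graph n → ℕ → Fin n → Fin n → Bool
reach G zero    u w = u == w
reach G (suc k) u w = reach G k u w ∨ any (λ x → reach G k u x ∧ adj G x w) (allFin _)

Connected : ∀ {n} → Graph n → Set
Connected G = ∀ u v → ∃ λ k → reach G k u v ≡ true

-- graph distance: least k with a walk of length ≤ k from u to w
-- (searched up to n; for connected graphs this is the shortest-path distance)
distFrom : ∀ {n} → Graph n → ℕ → ℕ → Fin n → Fin n → ℕ
distFrom G k zero      u w = k
distFrom G k (suc fuel) u w = if reach G k u w then k else distFrom G (suc k) fuel u w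

dist : ∀ {n} → Graph n → Fin n → Fin n → ℕ
dist {n} G u w = distFrom G 0 n u w

edges : ∀ {n} → Graph n → List (Fin n × Fin n)
edges {n} G = concatMap (λ u → map (λ v → (u , v))
                 (filter (λ v → T? ((toℕ u <ᵇ toℕ v) ∧ adj G u v)) (allFin n))) (allFin n)

numEdges : ∀ {n} → Graph n → ℕ
numEdges G = length (edges G)

degree : ∀ {n} → Graph n → Fin n → ℕ
degree {n} G v = length (filter (λ w → T? (adj G v w)) (allFin n))

count : ∀ {n} → (Fin n → Bool) → ℕ
count {n} p = length (filter (λ w → T? (p w)) (allFin n))

nU : ∀ {n} → Graph n → Fin n → Fin n → ℕ
nU G u v = count (λ w → dist G u w <ᵇ dist G v w)

n0 : ∀ {n} → Graph n → Fin n → Fin n → ℕ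
n0 G u v = count (λ w → dist G u w ≡ᵇ dist G v w)

edgeTerm : ∀ {n} → Graph n → Fin n × Fin n → ℚ
edgeTerm G (u , v) =
  ((+ (2 * nU G u v + n0 G u v)) / 2) *ℚ ((+ (2 * nU G v u + n0 G u v)) / 2)

Sz* : ∀ {n} → Graph n → ℚ
Sz* G = foldr _+ℚ_ 0ℚ (map (edgeTerm G) (edges G))

-- B_n on vertices 0..n-1: vertices 0..n-2 form the cycle C_{n-1}
-- (i ~ i+1, and 0 ~ n-2); vertex n-1 duplicates vertex 0, i.e. it is
-- adjacent exactly to 1 and n-2.
BAdjℕ : ℕ → ℕ → ℕ → Bool
BAdjℕ n i j =
  if (i <ᵇ n ∸ 1) ∧ (j <ᵇ n ∸ 1)
  then ((suc i ≡ᵇ j) ∨ (suc j ≡ᵇ i) ∨ ((i ≡ᵇ 0) ∧ (j ≡ᵇ n ∸ 2)) ∨ ((j ≡ᵇ 0) ∧ (i ≡ᵇ n ∸ 2)))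
  else (((i ≡ᵇ n ∸ 1) ∧ ((j ≡ᵇ 1) ∨ (j ≡ᵇ n ∸ 2))) ∨ ((j ≡ᵇ n ∸ 1) ∧ ((i ≡ᵇ 1) ∨ (i ≡ᵇ n ∸ 2))))

≡ᵇ-sym : ∀ a b → (a ≡ᵇ b) ≡ (b ≡ᵇ a)
≡ᵇ-sym zero zero = refl
≡ᵇ-sym zero (suc b) = refl
≡ᵇ-sym (suc a) zero = refl
≡ᵇ-sym (suc a) (suc b) = ≡ᵇ-sym a b

≡ᵇ-refl : ∀ a → (a ≡ᵇ a) ≡ true
≡ᵇ-refl zero = refl
≡ᵇ-refl (suc a) = ≡ᵇ-refl a

mkGraph : ∀ {n} → (Fin n → Fin n → Bool) → Graph n
mkGraph R = record
  { adj = λ i j → not (i == j) ∧ (R i j ∨ R j i)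
  ; sym = λ i j → cong₂ (λ a b → not a ∧ b) (≡ᵇ-sym (toℕ i) (toℕ j)) (∨-comm (R i j) (R j i))
  ; irrefl = λ i → cong (λ a → not a ∧ (R i i ∨ R i i)) (≡ᵇ-refl (toℕ i)) }

B : (n : ℕ) → Graph n
B n = mkGraph (λ i j → BAdjℕ n (toℕ i) (toℕ j))

-- Write w(uv) = (2n_u + n_0)(2n_v + n_0), so that Sz* is the sum of w over the edges divided by 4.
-- Since n_u + n_v + n_0 = n, AM-GM gives w ≤ n² on every edge; on a pendant edge with leaf p only p
-- itself is at least as close to p as to its neighbour, so there w ≤ 4(n - 1). The n + 1 edges of G
-- thus give Σ w ≤ n³ + 4(n - 1). In B_n every edge uv projects onto an edge u → u + 1 of the cycle
-- C_{n-1} (the twin onto the vertex it duplicates); u with the k - 1 cycle positions behind it are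
-- strictly closer to u, and v with the k - 1 positions ahead of it strictly closer to v, where
-- k = ⌊(n - 1)/2⌋. Hence each of the at least n + 1 edges of B_n has w ≥ 4k(n - k), and
-- (n + 1)·4k(n - k) > n³ + 4(n - 1) for all n ≥ 7 except n = 8; B_6 and B_8 are computed.

module Submission where

open import Defs hiding (sym)
import Algebra.Properties.CommutativeSemigroup as CommSemigroupProperties
open import Data.Bool using (Bool; true; false; _∧_; _∨_; not; T; if_then_else_)
open import Data.Bool.ListAction using (any)
open import Data.Bool.Properties using (T?) renaming (_≟_ to _≟ᵇ_)
open import Data.Empty using (⊥; ⊥-elim)
open import Data.Fin using (Fin; toℕ; fromℕ<) renaming (zero to fzero; suc to fsuc)
open import Data.Fin.Properties using (toℕ-injective; toℕ<n; toℕ-fromℕ<; ¬∀⟶∃¬; all?)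
open import Data.Integer as ℤ using (+<+) renaming (+_ to pos)
open import Data.Integer.Properties using (pos-*; pos-+)
open import Data.List using (List; []; _∷_; allFin; filter; length; map; concatMap; tabulate; foldr)
open import Data.List.Membership.Propositional using (_∈_; lose; find)
open import Data.List.Membership.Propositional.Properties using (∈-filter⁺; ∈-filter⁻; ∈-allFin; ∈-map⁺; ∈-map⁻; ∈-concatMap⁺; ∈-concatMap⁻)
open import Data.List.Properties using (length-++; length-map)
open import Data.List.Relation.Unary.Any using (here; there)
open import Data.Nat using (ℕ; zero; suc; _+_; _*_; _∸_; _⊓_; _%_; _≡ᵇ_; _<ᵇ_; _≤_; _<_; z≤n; s≤s; _≤?_; _<?_; _≤′_; ≤′-refl; ≤′-step; NonZero; >-nonZero)
open import Data.Nat.DivMod using (%-distribˡ-+; m%n%n≡m%n; m%n<n; m<n⇒m%n≡m; n%n≡0; [m+n]%n≡m%n)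
open import Data.Nat.ListAction using (sum)
open import Data.Nat.Properties
open import Data.Nat.Tactic.RingSolver using (solve-∀)
open import Data.Product using (_×_; _,_; ∃; proj₁; proj₂)
open import Data.Rational using (_/_; 0ℚ) renaming (_+_ to _+ℚ_; _*_ to _*ℚ_; _<_ to _<ℚ_)
open import Data.Rational.Properties using (toℚᵘ-injective; toℚᵘ-fromℚᵘ; toℚᵘ-homo-*; toℚᵘ-homo-+; toℚᵘ-cancel-<)
open import Data.Rational.Unnormalised using (mkℚᵘ; *≡*; *<*)
open import Data.Rational.Unnormalised.Properties using (≃-trans; ≃-sym; *-cong; +-cong; <-respˡ-≃; <-respʳ-≃)
open import Data.Sum using (_⊎_; inj₁; inj₂)
open import Data.Unit using (tt)
open import Function using (_∘_; id)
open import Relation.Binary using (tri<; tri≈; tri>)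
open import Relation.Binary.PropositionalEquality
open import Relation.Nullary using (¬_; yes; no)

∨-true⁻ : ∀ {a b} → (a ∨ b) ≡ true → a ≡ true ⊎ b ≡ true
∨-true⁻ {true}  _ = inj₁ refl
∨-true⁻ {false} e = inj₂ e

∧-true⁻ : ∀ {a b} → (a ∧ b) ≡ true → a ≡ true × b ≡ true
∧-true⁻ {true} {true} _ = refl , refl

∨-trueˡ : ∀ {a} b → a ≡ true → (a ∨ b) ≡ true
∨-trueˡ b refl = refl

∨-trueʳ : ∀ a {b} → b ≡ true → (a ∨ b) ≡ true
∨-trueʳ true  _ = refl
∨-trueʳ false e = e

∧-true⁺ : ∀ {a b} → a ≡ true → b ≡ true → (a ∧ b) ≡ true
∧-true⁺ refl refl = refl

T⇒≡true : ∀ {b} → T b → b ≡ true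
T⇒≡true {true} _ = refl

≡true⇒T : ∀ {b} → b ≡ true → T b
≡true⇒T refl = tt

≡ᵇ-true⇒≡ : ∀ {a b} → (a ≡ᵇ b) ≡ true → a ≡ b
≡ᵇ-true⇒≡ {a} {b} e = ≡ᵇ⇒≡ a b (≡true⇒T e)

≡⇒≡ᵇ-true : ∀ {a b} → a ≡ b → (a ≡ᵇ b) ≡ true
≡⇒≡ᵇ-true {a} refl = ≡ᵇ-refl a

≢⇒≡ᵇ-false : ∀ {a b} → ¬ a ≡ b → (a ≡ᵇ b) ≡ false
≢⇒≡ᵇ-false {a} {b} a≢b with a ≡ᵇ b in e
... | true  = ⊥-elim (a≢b (≡ᵇ-true⇒≡ e))
... | false = refl

<ᵇ-true⇒< : ∀ {a b} → (a <ᵇ b) ≡ true → a < b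
<ᵇ-true⇒< {a} {b} e = <ᵇ⇒< a b (≡true⇒T e)

<⇒<ᵇ-true : ∀ {a b} → a < b → (a <ᵇ b) ≡ true
<⇒<ᵇ-true a<b = T⇒≡true (<⇒<ᵇ a<b)

≮⇒<ᵇ-false : ∀ {a b} → ¬ a < b → (a <ᵇ b) ≡ false
≮⇒<ᵇ-false {a} {b} a≮b with a <ᵇ b in e
... | true  = ⊥-elim (a≮b (<ᵇ-true⇒< e))
... | false = refl

==⇒≡ : ∀ {n} {u w : Fin n} → (u == w) ≡ true → u ≡ w
==⇒≡ e = toℕ-injective (≡ᵇ-true⇒≡ e)

==-refl : ∀ {n} (u : Fin n) → (u == u) ≡ true
==-refl u = ≡ᵇ-refl (toℕ u)

≢⇒==-false : ∀ {n} {u w : Fin n} → ¬ u ≡ w → (u == w) ≡ false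
≢⇒==-false u≢w = ≢⇒≡ᵇ-false (λ e → u≢w (toℕ-injective e))

==-false⇒≢ : ∀ {n} {u w : Fin n} → (u == w) ≡ false → ¬ u ≡ w
==-false⇒≢ {u = u} e refl with trans (sym e) (==-refl u)
... | ()

𝟙 : Bool → ℕ
𝟙 true  = 1
𝟙 false = 0

𝟙≤1 : ∀ b → 𝟙 b ≤ 1
𝟙≤1 true  = s≤s z≤n
𝟙≤1 false = z≤n

𝟙-mono : ∀ {a b} → (a ≡ true → b ≡ true) → 𝟙 a ≤ 𝟙 b
𝟙-mono {true}  a⇒b rewrite a⇒b refl = ≤-refl
𝟙-mono {false} _ = z≤n

𝟙-strict : ∀ {a b} → (a ≡ true → b ≡ true) → ¬ b ≡ a → 𝟙 a < 𝟙 b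
𝟙-strict {true}  a⇒b b≢a = ⊥-elim (b≢a (a⇒b refl))
𝟙-strict {false} {true}  _ _   = s≤s z≤n
𝟙-strict {false} {false} _ b≢a = ⊥-elim (b≢a refl)

∑ : ∀ n → (Fin n → ℕ) → ℕ
∑ zero    f = 0
∑ (suc n) f = f fzero + ∑ n (f ∘ fsuc)

∑-cong : ∀ n {f g : Fin n → ℕ} → (∀ x → f x ≡ g x) → ∑ n f ≡ ∑ n g
∑-cong zero    f≡g = refl
∑-cong (suc n) f≡g = cong₂ _+_ (f≡g fzero) (∑-cong n (f≡g ∘ fsuc))

∑-mono-≤ : ∀ n {f g : Fin n → ℕ} → (∀ x → f x ≤ g x) → ∑ n f ≤ ∑ n g
∑-mono-≤ zero    f≤g = z≤n
∑-mono-≤ (suc n) f≤g = +-mono-≤ (f≤g fzero) (∑-mono-≤ n (f≤g ∘ fsuc))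

∑-mono-< : ∀ n {f g : Fin n → ℕ} → (∀ x → f x ≤ g x) → ∀ w → f w < g w → ∑ n f < ∑ n g
∑-mono-< (suc n) f≤g fzero    lt = +-mono-<-≤ lt (∑-mono-≤ n (f≤g ∘ fsuc))
∑-mono-< (suc n) f≤g (fsuc w) lt = +-mono-≤-< (f≤g fzero) (∑-mono-< n (f≤g ∘ fsuc) w lt)

∑-distrib-+ : ∀ n (f g : Fin n → ℕ) → ∑ n (λ x → f x + g x) ≡ ∑ n f + ∑ n g
∑-distrib-+ zero    f g = refl
∑-distrib-+ (suc n) f g =
  trans (cong ((f fzero + g fzero) +_) (∑-distrib-+ n (f ∘ fsuc) (g ∘ fsuc)))
        (+-interchange (f fzero) (g fzero) (∑ n (f ∘ fsuc)) (∑ n (g ∘ fsuc)))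
  where open CommSemigroupProperties +-commutativeSemigroup renaming (interchange to +-interchange)

∑-const : ∀ n c → ∑ n (λ _ → c) ≡ n * c
∑-const zero    c = refl
∑-const (suc n) c = cong (c +_) (∑-const n c)

∑-point : ∀ n (f : Fin n → ℕ) w → f w ≤ ∑ n f
∑-point (suc n) f fzero    = m≤m+n (f fzero) _
∑-point (suc n) f (fsuc w) = ≤-trans (∑-point n (f ∘ fsuc) w) (m≤n+m _ (f fzero))

∑-two-points : ∀ n (f : Fin n → ℕ) {a b} → ¬ a ≡ b → f a + f b ≤ ∑ n f
∑-two-points (suc n) f {fzero}   {fzero}   a≢b = ⊥-elim (a≢b refl)
∑-two-points (suc n) f {fzero}   {fsuc b}  _   = +-monoʳ-≤ (f fzero) (∑-point n (f ∘ fsuc) b)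
∑-two-points (suc n) f {fsuc a}  {fzero}   _   = subst (_≤ ∑ (suc n) f) (+-comm (f fzero) (f (fsuc a)))
                                                   (+-monoʳ-≤ (f fzero) (∑-point n (f ∘ fsuc) a))
∑-two-points (suc n) f {fsuc a}  {fsuc b}  a≢b = ≤-trans (∑-two-points n (f ∘ fsuc) (a≢b ∘ cong fsuc)) (m≤n+m _ (f fzero))

∑-𝟙≤ : ∀ n (b : Fin n → Bool) → ∑ n (𝟙 ∘ b) ≤ n
∑-𝟙≤ n b = subst (∑ n (𝟙 ∘ b) ≤_) (trans (∑-const n 1) (*-identityʳ n)) (∑-mono-≤ n (𝟙≤1 ∘ b))

∑-𝟙< : ∀ n (b : Fin n → Bool) w → b w ≡ false → ∑ n (𝟙 ∘ b) < n
∑-𝟙< (suc n) b fzero    e rewrite e = s≤s (∑-𝟙≤ n (b ∘ fsuc))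
∑-𝟙< (suc n) b (fsuc w) e = +-mono-≤-< (𝟙≤1 (b fzero)) (∑-𝟙< n (b ∘ fsuc) w e)

∑-𝟙-== : ∀ n (u : Fin n) → ∑ n (λ w → 𝟙 (w == u)) ≡ 1
∑-𝟙-== (suc n) fzero    = cong suc (trans (∑-const n 0) (*-zeroʳ n))
∑-𝟙-== (suc n) (fsuc u) = ∑-𝟙-== n u

∑-𝟙-toℕ< : ∀ n k → k ≤ n → ∑ n (λ u → 𝟙 (toℕ u <ᵇ k)) ≡ k
∑-𝟙-toℕ< zero    zero    _         = refl
∑-𝟙-toℕ< (suc n) zero    _         = trans (∑-const (suc n) 0) (*-zeroʳ (suc n))
∑-𝟙-toℕ< (suc n) (suc k) (s≤s k≤n) = cong suc (∑-𝟙-toℕ< n k k≤n)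

inRange : ℕ → ℕ → Bool
inRange h f = (0 <ᵇ f) ∧ (f <ᵇ suc h)

inRange⇒ : ∀ {h f} → inRange h f ≡ true → 0 < f × f ≤ h
inRange⇒ {h} {f} e = <ᵇ-true⇒< (proj₁ (∧-true⁻ {0 <ᵇ f} e)) , ≤-pred (<ᵇ-true⇒< (proj₂ (∧-true⁻ {0 <ᵇ f} e)))

𝟙-inRange-suc : ∀ f h → 𝟙 (inRange (suc h) f) ≡ 𝟙 (f ≡ᵇ suc h) + 𝟙 (inRange h f)
𝟙-inRange-suc zero    h = refl
𝟙-inRange-suc (suc f) h = <ᵇ-split f h
  where
  <ᵇ-split : ∀ f h → 𝟙 (f <ᵇ suc h) ≡ 𝟙 (f ≡ᵇ h) + 𝟙 (f <ᵇ h)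
  <ᵇ-split zero    zero    = refl
  <ᵇ-split zero    (suc h) = refl
  <ᵇ-split (suc f) zero    = refl
  <ᵇ-split (suc f) (suc h) = <ᵇ-split f h

∑-𝟙-inRange≥ : ∀ n (F : Fin n → ℕ) h → (∀ {j} → j ≤ h → ∃ λ w → F w ≡ j) →
  h ≤ ∑ n (𝟙 ∘ inRange h ∘ F)
∑-𝟙-inRange≥ n F zero    hits = z≤n
∑-𝟙-inRange≥ n F (suc h) hits with hits ≤-refl
... | w , Fw≡1+h = begin
  suc h                                      ≤⟨ +-mono-≤ hit-at-w (∑-𝟙-inRange≥ n F h (hits ∘ m≤n⇒m≤1+n)) ⟩
  ∑ n (𝟙 ∘ at-1+h) + ∑ n (𝟙 ∘ inRange h ∘ F)  ≡⟨ ∑-distrib-+ n (𝟙 ∘ at-1+h) (𝟙 ∘ inRange h ∘ F) ⟨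
  ∑ n (λ w → 𝟙 (at-1+h w) + 𝟙 (inRange h (F w)))
                                             ≡⟨ ∑-cong n (λ w → 𝟙-inRange-suc (F w) h) ⟨
  ∑ n (𝟙 ∘ inRange (suc h) ∘ F)              ∎
  where
  open ≤-Reasoning
  at-1+h : Fin n → Bool
  at-1+h w = F w ≡ᵇ suc h
  hit-at-w : 1 ≤ ∑ n (𝟙 ∘ at-1+h)
  hit-at-w = ≤-trans (≤-reflexive (cong 𝟙 (sym (≡⇒≡ᵇ-true Fw≡1+h)))) (∑-point n (𝟙 ∘ at-1+h) w)

length-filter-tabulate : ∀ {A : Set} n (p : A → Bool) (g : Fin n → A) →
  length (filter (λ x → T? (p x)) (tabulate g)) ≡ ∑ n (λ i → 𝟙 (p (g i)))
length-filter-tabulate zero    p g = refl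
length-filter-tabulate (suc n) p g with p (g fzero)
... | true  = cong suc (length-filter-tabulate n p (g ∘ fsuc))
... | false = length-filter-tabulate n p (g ∘ fsuc)

count≡∑ : ∀ {n} (p : Fin n → Bool) → count p ≡ ∑ n (𝟙 ∘ p)
count≡∑ {n} p = length-filter-tabulate n p id

count-cong : ∀ {n} {p q : Fin n → Bool} → (∀ w → p w ≡ q w) → count p ≡ count q
count-cong {n} {p} {q} p≡q = trans (count≡∑ p) (trans (∑-cong n (cong 𝟙 ∘ p≡q)) (sym (count≡∑ q)))

any-tabulate⁺ : ∀ {A : Set} n (f : A → Bool) (g : Fin n → A) w → f (g w) ≡ true → any f (tabulate g) ≡ true
any-tabulate⁺ (suc n) f g fzero    e = ∨-trueˡ _ e
any-tabulate⁺ (suc n) f g (fsuc w) e = ∨-trueʳ (f (g fzero)) (any-tabulate⁺ n f (g ∘ fsuc) w e)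

any-tabulate⁻ : ∀ {A : Set} n (f : A → Bool) (g : Fin n → A) → any f (tabulate g) ≡ true → ∃ λ w → f (g w) ≡ true
any-tabulate⁻ (suc n) f g e with ∨-true⁻ {f (g fzero)} e
... | inj₁ f0 = fzero , f0
... | inj₂ rest with any-tabulate⁻ n f (g ∘ fsuc) rest
...   | w , fw = fsuc w , fw

any-cong : ∀ {A : Set} {f g : A → Bool} (xs : List A) → (∀ x → f x ≡ g x) → any f xs ≡ any g xs
any-cong []       f≡g = refl
any-cong (x ∷ xs) f≡g = cong₂ _∨_ (f≡g x) (any-cong xs f≡g)

-- Walks and distances

Lipschitz : ∀ {n} → Graph n → (Fin n → ℕ) → Set
Lipschitz G φ = ∀ x y → adj G x y ≡ true → φ y ≤ suc (φ x)

module Reachability {n : ℕ} (G : Graph n) where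

  reach-suc : ∀ k {u w} → reach G k u w ≡ true → reach G (suc k) u w ≡ true
  reach-suc k e = ∨-trueˡ _ e

  reach-mono : ∀ {k k′ u w} → k ≤ k′ → reach G k u w ≡ true → reach G k′ u w ≡ true
  reach-mono k≤k′ = go (≤⇒≤′ k≤k′)
    where
    go : ∀ {k k′ u w} → k ≤′ k′ → reach G k u w ≡ true → reach G k′ u w ≡ true
    go ≤′-refl        e = e
    go {k′ = suc k′} {u} {w} (≤′-step k≤′k′) e = reach-suc k′ {u} {w} (go k≤′k′ e)

  reach-refl : ∀ k u → reach G k u u ≡ true
  reach-refl k u = reach-mono {0} {k} {u} {u} z≤n (==-refl u)

  reach-step : ∀ k {u x w} → reach G k u x ≡ true → adj G x w ≡ true → reach G (suc k) u w ≡ true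
  reach-step k {u} {x} {w} r a = ∨-trueʳ (reach G k u w)
    (any-tabulate⁺ n (λ y → reach G k u y ∧ adj G y w) id x (∧-true⁺ r a))

  reach-suc⁻ : ∀ k {u w} → reach G (suc k) u w ≡ true →
    reach G k u w ≡ true ⊎ ∃ λ x → reach G k u x ≡ true × adj G x w ≡ true
  reach-suc⁻ k {u} {w} e with ∨-true⁻ {reach G k u w} e
  ... | inj₁ r = inj₁ r
  ... | inj₂ r with any-tabulate⁻ n (λ y → reach G k u y ∧ adj G y w) id r
  ...   | x , rx = inj₂ (x , ∧-true⁻ rx)

  reach⇒≤+ : ∀ {φ} → Lipschitz G φ → ∀ k {u w} → reach G k u w ≡ true → φ w ≤ φ u + k
  reach⇒≤+ {φ} lip zero {u} e rewrite ==⇒≡ {u = u} e = m≤m+n (φ _) 0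
  reach⇒≤+ {φ} lip (suc k) {u} {w} e with reach-suc⁻ k e
  ... | inj₁ r = ≤-trans (reach⇒≤+ lip k r) (+-monoʳ-≤ (φ u) (n≤1+n k))
  ... | inj₂ (x , r , a) = begin
    φ w             ≤⟨ lip x w a ⟩
    suc (φ x)       ≤⟨ s≤s (reach⇒≤+ lip k r) ⟩
    suc (φ u + k)   ≡⟨ +-suc (φ u) k ⟨
    φ u + suc k     ∎
    where open ≤-Reasoning

  module Stabilisation (u : Fin n) where

    Stable : ℕ → Set
    Stable k = ∀ w → reach G (suc k) u w ≡ reach G k u w

    stable-suc : ∀ {k} → Stable k → Stable (suc k)
    stable-suc st w = cong₂ _∨_ (st w) (any-cong (allFin n) (λ x → cong (_∧ adj G x w) (st x)))

    stable-reach : ∀ {k} → Stable k → ∀ d w → reach G (d + k) u w ≡ reach G k u w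
    stable-reach st zero    w = refl
    stable-reach {k} st (suc d) w = trans (stable-+ d w) (stable-reach st d w)
      where
      stable-+ : ∀ d → Stable (d + k)
      stable-+ zero    = st
      stable-+ (suc d) = stable-suc {d + k} (stable-+ d)

    reached : ℕ → ℕ
    reached k = ∑ n (𝟙 ∘ reach G k u)

    stable-or-grows : ∀ k → Stable k ⊎ reached k < reached (suc k)
    stable-or-grows k with all? (λ w → reach G (suc k) u w ≟ᵇ reach G k u w)
    ... | yes st = inj₁ st
    ... | no ¬st with ¬∀⟶∃¬ n _ (λ w → reach G (suc k) u w ≟ᵇ reach G k u w) ¬st
    ...   | w , changed = inj₂ (∑-mono-< n (λ x → 𝟙-mono (reach-suc k)) w (𝟙-strict (reach-suc k) changed))

    stable-or-large : ∀ k → (∃ λ j → j ≤ k × Stable j) ⊎ suc k ≤ reached k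
    stable-or-large zero = inj₂ (≤-trans (≤-reflexive (cong 𝟙 (sym (==-refl u)))) (∑-point n (𝟙 ∘ reach G 0 u) u))
    stable-or-large (suc k) with stable-or-large k
    ... | inj₁ (j , j≤k , st) = inj₁ (j , m≤n⇒m≤1+n j≤k , st)
    ... | inj₂ large with stable-or-grows k
    ...   | inj₁ st = inj₁ (k , n≤1+n k , st)
    ...   | inj₂ grows = inj₂ (≤-trans (s≤s large) grows)

  -- A walk of any length can be shortened to one of length n - 1: the set reached in k steps
  -- grows strictly until it stabilises, so it is stable or everything by step n - 1.
  connected⇒reach : Connected G → ∀ {m} → n ≡ suc m → ∀ u w → reach G m u w ≡ true
  connected⇒reach conn {m} refl u w with reach G m u w in e
  ... | true  = refl
  ... | false with Stabilisation.stable-or-large u m | conn u w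
  ...   | inj₂ large | _ = ⊥-elim (<⇒≱ (∑-𝟙< n (reach G m u) w e) large)
  ...   | inj₁ (j , j≤m , st) | K , rK with K ≤? m
  ...     | yes K≤m = trans (sym e) (reach-mono K≤m rK)
  ...     | no  K≰m = trans (sym e) (reach-mono j≤m rj)
    where
    j≤K : j ≤ K
    j≤K = ≤-trans j≤m (<⇒≤ (≰⇒> K≰m))
    rj : reach G j u w ≡ true
    rj = trans (sym (trans (cong (λ z → reach G z u w) (sym (m∸n+n≡m j≤K)))
                           (Stabilisation.stable-reach u st (K ∸ j) w))) rK

  distFrom-≤ : ∀ k f u w → distFrom G k f u w ≤ k + f
  distFrom-≤ k zero    u w = ≤-reflexive (sym (+-identityʳ k))
  distFrom-≤ k (suc f) u w with reach G k u w
  ... | true  = m≤m+n k (suc f)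
  ... | false = subst (distFrom G (suc k) f u w ≤_) (sym (+-suc k f)) (distFrom-≤ (suc k) f u w)

  distFrom-≤-reach : ∀ k f {j u w} → reach G j u w ≡ true → k ≤ j → j < k + f → distFrom G k f u w ≤ j
  distFrom-≤-reach k zero    r k≤j j<k+0 = ⊥-elim (<⇒≱ j<k+0 (subst (_≤ _) (sym (+-identityʳ k)) k≤j))
  distFrom-≤-reach k (suc f) {j} {u} {w} r k≤j j<k+f with reach G k u w in e
  ... | true  = k≤j
  ... | false with m≤n⇒m<n∨m≡n k≤j
  ...   | inj₁ k<j = distFrom-≤-reach (suc k) f r k<j (subst (j <_) (+-suc k f) j<k+f)
  ...   | inj₂ refl with trans (sym e) r
  ...     | ()

  distFrom-reaches : ∀ k f u w → distFrom G k f u w ≡ k + f ⊎ reach G (distFrom G k f u w) u w ≡ true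
  distFrom-reaches k zero    u w = inj₁ (sym (+-identityʳ k))
  distFrom-reaches k (suc f) u w with reach G k u w in e
  ... | true  = inj₂ e
  ... | false with distFrom-reaches (suc k) f u w
  ...   | inj₁ d≡ = inj₁ (trans d≡ (sym (+-suc k f)))
  ...   | inj₂ r  = inj₂ r

  dist≤ : ∀ {j u w} → reach G j u w ≡ true → j < n → dist G u w ≤ j
  dist≤ r j<n = distFrom-≤-reach 0 n r z≤n j<n

  dist≤n : ∀ u w → dist G u w ≤ n
  dist≤n u w = distFrom-≤ 0 n u w

  -- dist defaults to n when no walk of length < n exists, hence the hypothesis φ w ≤ n.
  lipschitz⇒≤dist : ∀ {φ} → Lipschitz G φ → ∀ {u w} → φ u ≡ 0 → φ w ≤ n → φ w ≤ dist G u w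
  lipschitz⇒≤dist {φ} lip {u} {w} φu≡0 φw≤n with distFrom-reaches 0 n u w
  ... | inj₁ d≡n = subst (φ w ≤_) (sym d≡n) φw≤n
  ... | inj₂ r   = subst (φ w ≤_) (cong (_+ dist G u w) φu≡0) (reach⇒≤+ lip (dist G u w) r)

  connected⇒dist<n : Connected G → ∀ u w → dist G u w < n
  connected⇒dist<n conn u w = subst (dist G u w <_) (sym n≡1+m) (s≤s (dist≤ (connected⇒reach conn n≡1+m u w) m<n))
    where
    n≡1+m : n ≡ suc (n ∸ 1)
    n≡1+m = nonempty u
      where
      nonempty : ∀ {k} → Fin k → k ≡ suc (k ∸ 1)
      nonempty fzero    = refl
      nonempty (fsuc _) = refl
    m<n : n ∸ 1 < n
    m<n = subst (n ∸ 1 <_) (sym n≡1+m) ≤-refl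

-- Edge weights

sum-map-≤ : ∀ {A : Set} (f : A → ℕ) {N} → (∀ x → f x ≤ N) → ∀ xs → sum (map f xs) ≤ length xs * N
sum-map-≤ f f≤N []       = z≤n
sum-map-≤ f f≤N (x ∷ xs) = +-mono-≤ (f≤N x) (sum-map-≤ f f≤N xs)

sum-map-≥ : ∀ {A : Set} (f : A → ℕ) {L} xs → (∀ {x} → x ∈ xs → L ≤ f x) → length xs * L ≤ sum (map f xs)
sum-map-≥ f []       L≤f = z≤n
sum-map-≥ f (x ∷ xs) L≤f = +-mono-≤ (L≤f (here refl)) (sum-map-≥ f xs (L≤f ∘ there))

sum-map-≤-but-one : ∀ {A : Set} (f : A → ℕ) {N P x xs} → (∀ y → f y ≤ N) → x ∈ xs → f x ≤ P →
  sum (map f xs) + N ≤ length xs * N + P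
sum-map-≤-but-one f {N} {P} {x} f≤N (here {xs = xs} refl) fx≤P = begin
  f x + sum (map f xs) + N     ≤⟨ +-monoˡ-≤ N (+-mono-≤ fx≤P (sum-map-≤ f f≤N xs)) ⟩
  P + length xs * N + N        ≡⟨ rearrange P (length xs * N) N ⟩
  N + length xs * N + P        ∎
  where
  open ≤-Reasoning
  rearrange : ∀ a b c → a + b + c ≡ c + b + a
  rearrange = solve-∀
sum-map-≤-but-one f {N} {P} f≤N (there {x = y} {xs = xs} x∈xs) fx≤P = begin
  f y + sum (map f xs) + N     ≡⟨ +-assoc (f y) _ N ⟩
  f y + (sum (map f xs) + N)   ≤⟨ +-mono-≤ (f≤N y) (sum-map-≤-but-one f f≤N x∈xs fx≤P) ⟩
  N + (length xs * N + P)      ≡⟨ +-assoc N _ P ⟨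
  N + length xs * N + P        ∎
  where open ≤-Reasoning

upEdge : ∀ {n} → Graph n → Fin n → Fin n → Bool
upEdge G u v = (toℕ u <ᵇ toℕ v) ∧ adj G u v

upNeighbours : ∀ {n} → Graph n → Fin n → List (Fin n)
upNeighbours {n} G u = filter (T? ∘ upEdge G u) (allFin n)

𝟙-upEdge : ∀ {n} (G : Graph n) {u v} → toℕ u < toℕ v → adj G u v ≡ true → 𝟙 (upEdge G u v) ≡ 1
𝟙-upEdge G u<v a rewrite <⇒<ᵇ-true u<v | a = refl

edgesFrom : ∀ {n} → Graph n → Fin n → List (Fin n × Fin n)
edgesFrom G u = map (u ,_) (upNeighbours G u)

∈-edges⁺ : ∀ {n} (G : Graph n) {u v} → toℕ u < toℕ v → adj G u v ≡ true → (u , v) ∈ edges G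
∈-edges⁺ G {u} {v} u<v a = ∈-concatMap⁺ (edgesFrom G) (lose (∈-allFin u) (∈-map⁺ (u ,_) v∈))
  where
  v∈ : v ∈ upNeighbours G u
  v∈ = ∈-filter⁺ (T? ∘ upEdge G u) (∈-allFin v) (≡true⇒T (∧-true⁺ (<⇒<ᵇ-true u<v) a))

∈-edges⁻ : ∀ {n} (G : Graph n) {u v} → (u , v) ∈ edges G → adj G u v ≡ true
∈-edges⁻ {n} G e with find (∈-concatMap⁻ (edgesFrom G) {xs = allFin n} e)
... | x , _ , uv∈ with ∈-map⁻ (x ,_) uv∈
...   | y , y∈ , refl = proj₂ (∧-true⁻ (T⇒≡true (proj₂ (∈-filter⁻ (T? ∘ upEdge G x) {xs = allFin n} y∈))))

length-concatMap-tabulate : ∀ {A B : Set} n (f : A → List B) (g : Fin n → A) →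
  length (concatMap f (tabulate g)) ≡ ∑ n (length ∘ f ∘ g)
length-concatMap-tabulate zero    f g = refl
length-concatMap-tabulate (suc n) f g =
  trans (length-++ (f (g fzero))) (cong (length (f (g fzero)) +_) (length-concatMap-tabulate n f (g ∘ fsuc)))

numEdges≡∑ : ∀ {n} (G : Graph n) → numEdges G ≡ ∑ n (λ u → ∑ n (𝟙 ∘ upEdge G u))
numEdges≡∑ {n} G = trans (length-concatMap-tabulate n (edgesFrom G) id)
  (∑-cong n (λ u → trans (length-map (u ,_) (upNeighbours G u)) (length-filter-tabulate n (upEdge G u) id)))

[x/2]*[y/2]≡xy/4 : ∀ x y → ((pos x) / 2) *ℚ ((pos y) / 2) ≡ (pos (x * y)) / 4
[x/2]*[y/2]≡xy/4 x y = toℚᵘ-injective (≃-trans (toℚᵘ-homo-* ((pos x) / 2) ((pos y) / 2))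
  (≃-trans (*-cong (toℚᵘ-fromℚᵘ (mkℚᵘ (pos x) 1)) (toℚᵘ-fromℚᵘ (mkℚᵘ (pos y) 1)))
  (≃-trans (*≡* (cong (ℤ._* pos 4) (sym (pos-* x y)))) (≃-sym (toℚᵘ-fromℚᵘ (mkℚᵘ (pos (x * y)) 3))))))

x/4+y/4≡[x+y]/4 : ∀ x y → ((pos x) / 4) +ℚ ((pos y) / 4) ≡ (pos (x + y)) / 4
x/4+y/4≡[x+y]/4 x y = toℚᵘ-injective (≃-trans (toℚᵘ-homo-+ ((pos x) / 4) ((pos y) / 4))
  (≃-trans (+-cong (toℚᵘ-fromℚᵘ (mkℚᵘ (pos x) 3)) (toℚᵘ-fromℚᵘ (mkℚᵘ (pos y) 3)))
  (≃-trans (*≡* cross) (≃-sym (toℚᵘ-fromℚᵘ (mkℚᵘ (pos (x + y)) 3))))))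
  where
  identity : ∀ x y → (x * 4 + y * 4) * 4 ≡ (x + y) * 16
  identity = solve-∀
  cross : (pos x ℤ.* pos 4 ℤ.+ pos y ℤ.* pos 4) ℤ.* pos 4 ≡ pos (x + y) ℤ.* pos 16
  cross = begin
    (pos x ℤ.* pos 4 ℤ.+ pos y ℤ.* pos 4) ℤ.* pos 4  ≡⟨ cong (ℤ._* pos 4) (cong₂ ℤ._+_ (pos-* x 4) (pos-* y 4)) ⟨
    (pos (x * 4) ℤ.+ pos (y * 4)) ℤ.* pos 4          ≡⟨ cong (ℤ._* pos 4) (pos-+ (x * 4) (y * 4)) ⟨
    pos (x * 4 + y * 4) ℤ.* pos 4                    ≡⟨ pos-* (x * 4 + y * 4) 4 ⟨
    pos ((x * 4 + y * 4) * 4)                        ≡⟨ cong pos (identity x y) ⟩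
    pos ((x + y) * 16)                               ≡⟨ pos-* (x + y) 16 ⟩
    pos (x + y) ℤ.* pos 16                           ∎
    where open ≡-Reasoning

/4-mono-< : ∀ {x y} → x < y → ((pos x) / 4) <ℚ ((pos y) / 4)
/4-mono-< {x} {y} x<y = toℚᵘ-cancel-< (<-respˡ-≃ (≃-sym (toℚᵘ-fromℚᵘ (mkℚᵘ (pos x) 3)))
  (<-respʳ-≃ (≃-sym (toℚᵘ-fromℚᵘ (mkℚᵘ (pos y) 3)))
    (*<* (subst₂ ℤ._<_ (pos-* x 4) (pos-* y 4) (+<+ (*-monoˡ-< 4 x<y))))))

-- 4 · edgeTerm, which keeps the index integral.
weight : ∀ {n} → Graph n → Fin n × Fin n → ℕ
weight G (u , v) = (2 * nU G u v + n0 G u v) * (2 * nU G v u + n0 G u v)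

weights : ∀ {n} → Graph n → ℕ
weights G = sum (map (weight G) (edges G))

Sz*≡weights/4 : ∀ {n} (G : Graph n) → Sz* G ≡ (pos (weights G)) / 4
Sz*≡weights/4 G = go (edges G)
  where
  go : ∀ es → foldr _+ℚ_ 0ℚ (map (edgeTerm G) es) ≡ (pos (sum (map (weight G) es))) / 4
  go []             = refl
  go ((u , v) ∷ es) = trans (cong₂ _+ℚ_ ([x/2]*[y/2]≡xy/4 (2 * nU G u v + n0 G u v) (2 * nU G v u + n0 G u v)) (go es))
                            (x/4+y/4≡[x+y]/4 (weight G (u , v)) (sum (map (weight G) es)))

<ᵇ-trichotomy : ∀ x y → 𝟙 (x <ᵇ y) + 𝟙 (y <ᵇ x) + 𝟙 (x ≡ᵇ y) ≡ 1
<ᵇ-trichotomy zero    zero    = refl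
<ᵇ-trichotomy zero    (suc y) = refl
<ᵇ-trichotomy (suc x) zero    = refl
<ᵇ-trichotomy (suc x) (suc y) = <ᵇ-trichotomy x y

nU+nU+n0≡n : ∀ {n} (G : Graph n) u v → nU G u v + nU G v u + n0 G u v ≡ n
nU+nU+n0≡n {n} G u v = begin
  nU G u v + nU G v u + n0 G u v
    ≡⟨ cong₂ _+_ (cong₂ _+_ (count≡∑ closerU) (count≡∑ closerV)) (count≡∑ tied) ⟩
  ∑ n (𝟙 ∘ closerU) + ∑ n (𝟙 ∘ closerV) + ∑ n (𝟙 ∘ tied)
    ≡⟨ cong (_+ ∑ n (𝟙 ∘ tied)) (∑-distrib-+ n (𝟙 ∘ closerU) (𝟙 ∘ closerV)) ⟨
  ∑ n (λ w → 𝟙 (closerU w) + 𝟙 (closerV w)) + ∑ n (𝟙 ∘ tied)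
    ≡⟨ ∑-distrib-+ n _ (𝟙 ∘ tied) ⟨
  ∑ n (λ w → 𝟙 (closerU w) + 𝟙 (closerV w) + 𝟙 (tied w))
    ≡⟨ ∑-cong n (λ w → <ᵇ-trichotomy (dist G u w) (dist G v w)) ⟩
  ∑ n (λ _ → 1)
    ≡⟨ trans (∑-const n 1) (*-identityʳ n) ⟩
  n ∎
  where
  open ≡-Reasoning
  closerU closerV tied : Fin n → Bool
  closerU w = dist G u w <ᵇ dist G v w
  closerV w = dist G v w <ᵇ dist G u w
  tied    w = dist G u w ≡ᵇ dist G v w

n0-comm : ∀ {n} (G : Graph n) u v → n0 G u v ≡ n0 G v u
n0-comm G u v = count-cong (λ w → ≡ᵇ-sym (dist G u w) (dist G v w))

weight-comm : ∀ {n} (G : Graph n) u v → weight G (u , v) ≡ weight G (v , u)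
weight-comm G u v = trans (*-comm (2 * nU G u v + n0 G u v) _)
  (cong (λ c → (2 * nU G v u + c) * (2 * nU G u v + c)) (n0-comm G u v))

4x[x+d]≤[2x+d]² : ∀ x d → 4 * (x * (x + d)) ≤ (x + (x + d)) * (x + (x + d))
4x[x+d]≤[2x+d]² x d = subst (4 * (x * (x + d)) ≤_) (square x d) (m≤m+n _ (d * d))
  where
  square : ∀ x d → 4 * (x * (x + d)) + d * d ≡ (x + (x + d)) * (x + (x + d))
  square = solve-∀

4xy≤[x+y]² : ∀ x y → 4 * (x * y) ≤ (x + y) * (x + y)
4xy≤[x+y]² x y with ≤-total x y
... | inj₁ x≤y = subst (λ y → 4 * (x * y) ≤ (x + y) * (x + y)) (m+[n∸m]≡n x≤y) (4x[x+d]≤[2x+d]² x (y ∸ x))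
... | inj₂ y≤x = subst (λ x → 4 * (x * y) ≤ (x + y) * (x + y)) (m+[n∸m]≡n y≤x)
                   (subst₂ _≤_ (cong (4 *_) (*-comm y _)) (cong (λ s → s * s) (+-comm y _)) (4x[x+d]≤[2x+d]² y (x ∸ y)))

weight≤n² : ∀ {n} (G : Graph n) e → weight G e ≤ n * n
weight≤n² {n} G (u , v) = *-cancelˡ-≤ 4 (begin
  4 * ((2 * a + c) * (2 * b + c))     ≤⟨ 4xy≤[x+y]² (2 * a + c) (2 * b + c) ⟩
  (2 * a + c + (2 * b + c)) ^2        ≡⟨ cong _^2 (trans (sum-doubled a b c) (cong (2 *_) (nU+nU+n0≡n G u v))) ⟩
  (2 * n) ^2                          ≡⟨ double-square n ⟩
  4 * (n * n)                         ∎)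
  where
  open ≤-Reasoning
  a b c : ℕ
  a = nU G u v
  b = nU G v u
  c = n0 G u v
  _^2 : ℕ → ℕ
  x ^2 = x * x
  sum-doubled : ∀ a b c → 2 * a + c + (2 * b + c) ≡ 2 * (a + b + c)
  sum-doubled = solve-∀
  double-square : ∀ n → (2 * n) * (2 * n) ≡ 4 * (n * n)
  double-square = solve-∀

pendant-weight-bound : ∀ a b c {n} → 2 ≤ n → a + c ≤ 1 → a + b + c ≡ n → (2 * a + c) * (2 * b + c) ≤ 4 * (n ∸ 1)
pendant-weight-bound 0 b 0 _ _ _ = z≤n
pendant-weight-bound 1 b 0 _ _ refl = ≤-reflexive (identity b)
  where
  identity : ∀ b → (2 * 1 + 0) * (2 * b + 0) ≡ 4 * (b + 0)
  identity = solve-∀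
pendant-weight-bound 0 (suc b) 1 _ _ refl =
  ≤-trans (m≤m+n ((2 * 0 + 1) * (2 * suc b + 1)) (2 * b + 1)) (≤-reflexive (identity b))
  where
  identity : ∀ b → (2 * 0 + 1) * (2 * suc b + 1) + (2 * b + 1) ≡ 4 * (b + 1)
  identity = solve-∀
pendant-weight-bound 0 0 1 (s≤s ()) _ refl
pendant-weight-bound (suc (suc a)) b c _ (s≤s ()) _
pendant-weight-bound 1 b (suc c) _ (s≤s ()) _
pendant-weight-bound 0 b (suc (suc c)) _ (s≤s ()) _

-- With a = k + d and b = k + e: (2a + c)(2b + c) = 4k(n - k) + (2d + c)(2e + c).
4k[n∸k]≤[2a+c][2b+c] : ∀ {a b c n k} → k ≤ a → k ≤ b → a + b + c ≡ n → 4 * k * (n ∸ k) ≤ (2 * a + c) * (2 * b + c)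
4k[n∸k]≤[2a+c][2b+c] {a} {b} {c} {k = k} k≤a k≤b refl
  rewrite sym (m+[n∸m]≡n k≤a) | sym (m+[n∸m]≡n k≤b) = split k (a ∸ k) (b ∸ k) c
  where
  regroup : ∀ k d e c → (k + d) + (k + e) + c ≡ k + (d + (k + e) + c)
  regroup = solve-∀
  expand : ∀ k d e c → 4 * k * (d + (k + e) + c) + (2 * d + c) * (2 * e + c) ≡ (2 * (k + d) + c) * (2 * (k + e) + c)
  expand = solve-∀
  split : ∀ k d e c → 4 * k * ((k + d) + (k + e) + c ∸ k) ≤ (2 * (k + d) + c) * (2 * (k + e) + c)
  split k d e c rewrite regroup k d e c | m+n∸m≡n k (d + (k + e) + c) =
    subst (4 * k * (d + (k + e) + c) ≤_) (expand k d e c) (m≤m+n _ _)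

-- Pendant edges

unique-neighbour : ∀ {n} (G : Graph n) p → degree G p ≡ 1 →
  ∃ λ q → adj G p q ≡ true × (∀ w → adj G p w ≡ true → w ≡ q)
unique-neighbour {n} G p deg with filter (λ w → T? (adj G p w)) (allFin n) in nbrs
unique-neighbour G p () | []
unique-neighbour G p () | _ ∷ _ ∷ _
... | q ∷ [] = q , T⇒≡true (proj₂ (∈-filter⁻ (T? ∘ adj G p) {xs = allFin _} (subst (q ∈_) (sym nbrs) (here refl)))) , only-q
  where
  only-q : ∀ w → adj G p w ≡ true → w ≡ q
  only-q w a with subst (w ∈_) nbrs (∈-filter⁺ (T? ∘ adj G p) (∈-allFin w) (≡true⇒T a))
  ... | here w≡q = w≡q

<ᵇ+≡ᵇ≤1 : ∀ x y → 𝟙 (x <ᵇ y) + 𝟙 (x ≡ᵇ y) ≤ 1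
<ᵇ+≡ᵇ≤1 zero    zero    = ≤-refl
<ᵇ+≡ᵇ≤1 zero    (suc y) = ≤-refl
<ᵇ+≡ᵇ≤1 (suc x) zero    = z≤n
<ᵇ+≡ᵇ≤1 (suc x) (suc y) = <ᵇ+≡ᵇ≤1 x y

<ᵇ+≡ᵇ-> : ∀ {x y} → y < x → 𝟙 (x <ᵇ y) + 𝟙 (x ≡ᵇ y) ≡ 0
<ᵇ+≡ᵇ-> {suc x} {zero}  _         = refl
<ᵇ+≡ᵇ-> {suc x} {suc y} (s≤s y<x) = <ᵇ+≡ᵇ-> y<x

module Pendant {n} (G : Graph n) (conn : Connected G) {p q : Fin n}
               (pq : adj G p q ≡ true) (only-q : ∀ w → adj G p w ≡ true → w ≡ q) where
  open Reachability G

  walk-from-pendant : ∀ j {w} → reach G j p w ≡ true → w ≡ p ⊎ ∃ λ j′ → j ≡ suc j′ × reach G j′ q w ≡ true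
  walk-from-pendant zero    r = inj₁ (sym (==⇒≡ r))
  walk-from-pendant (suc j) {w} r with reach-suc⁻ j r
  ... | inj₁ r′ with walk-from-pendant j r′
  ...   | inj₁ w≡p = inj₁ w≡p
  ...   | inj₂ (j′ , refl , r″) = inj₂ (suc j′ , refl , reach-suc j′ r″)
  walk-from-pendant (suc j) {w} r | inj₂ (x , r′ , a) with walk-from-pendant j r′
  ... | inj₁ refl = inj₂ (j , refl , subst (λ z → reach G j q z ≡ true) (sym (only-q w a)) (reach-refl j q))
  ... | inj₂ (j′ , refl , r″) = inj₂ (suc j′ , refl , reach-step j′ r″ a)

  pendant-farther : ∀ {w} → ¬ w ≡ p → dist G q w < dist G p w
  pendant-farther {w} w≢p with distFrom-reaches 0 n p w
  ... | inj₁ dpw≡n = subst (dist G q w <_) (sym dpw≡n) (connected⇒dist<n conn q w)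
  ... | inj₂ r with walk-from-pendant (dist G p w) r
  ...   | inj₁ w≡p = ⊥-elim (w≢p w≡p)
  ...   | inj₂ (j , d≡1+j , r′) =
    subst (dist G q w <_) (sym d≡1+j) (s≤s (dist≤ r′ (subst (_≤ n) d≡1+j (dist≤n p w))))

  nU+n0≤1 : nU G p q + n0 G p q ≤ 1
  nU+n0≤1 = begin
    nU G p q + n0 G p q                      ≡⟨ cong₂ _+_ (count≡∑ closer) (count≡∑ tied) ⟩
    ∑ n (𝟙 ∘ closer) + ∑ n (𝟙 ∘ tied)        ≡⟨ ∑-distrib-+ n (𝟙 ∘ closer) (𝟙 ∘ tied) ⟨
    ∑ n (λ w → 𝟙 (closer w) + 𝟙 (tied w))   ≤⟨ ∑-mono-≤ n only-p ⟩
    ∑ n (λ w → 𝟙 (w == p))                  ≡⟨ ∑-𝟙-== n p ⟩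
    1                                         ∎
    where
    open ≤-Reasoning
    closer tied : Fin n → Bool
    closer w = dist G p w <ᵇ dist G q w
    tied   w = dist G p w ≡ᵇ dist G q w
    only-p : ∀ w → 𝟙 (closer w) + 𝟙 (tied w) ≤ 𝟙 (w == p)
    only-p w with w == p in e
    ... | true  = <ᵇ+≡ᵇ≤1 (dist G p w) (dist G q w)
    ... | false = ≤-reflexive (<ᵇ+≡ᵇ-> (pendant-farther (==-false⇒≢ e)))

  pendant-weight : 2 ≤ n → weight G (p , q) ≤ 4 * (n ∸ 1)
  pendant-weight n≥2 = pendant-weight-bound (nU G p q) (nU G q p) (n0 G p q) n≥2 nU+n0≤1 (nU+nU+n0≡n G p q)

pendant-edge : ∀ {n} (G : Graph n) → 2 ≤ n → Connected G → (∃ λ v → degree G v ≡ 1) →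
  ∃ λ e → e ∈ edges G × weight G e ≤ 4 * (n ∸ 1)
pendant-edge {n} G n≥2 conn (p , deg) with unique-neighbour G p deg
... | q , pq , only-q with <-cmp (toℕ p) (toℕ q)
...   | tri< p<q _ _ = (p , q) , ∈-edges⁺ G p<q pq , pendant-weight n≥2
  where open Pendant G conn pq only-q
...   | tri> _ _ q<p = (q , p) , ∈-edges⁺ G q<p (trans (Graph.sym G q p) pq) ,
                        subst (_≤ 4 * (n ∸ 1)) (weight-comm G p q) (pendant-weight n≥2)
  where open Pendant G conn pq only-q
...   | tri≈ _ p≡q _ with toℕ-injective p≡q
...     | refl with trans (sym pq) (irrefl G p)
...       | ()

pendantBound : ℕ → ℕ
pendantBound n = n * (n * n) + 4 * (n ∸ 1)

bicyclic-pendant-weights : ∀ {n} (G : Graph n) → 2 ≤ n → Connected G → numEdges G ≡ suc n →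
  (∃ λ v → degree G v ≡ 1) → weights G ≤ pendantBound n
bicyclic-pendant-weights {n} G n≥2 conn numEdges≡1+n pendant with pendant-edge G n≥2 conn pendant
... | e , e∈ , we≤ = +-cancelʳ-≤ (n * n) _ _ (begin
  weights G + n * n                            ≤⟨ sum-map-≤-but-one (weight G) (weight≤n² G) e∈ we≤ ⟩
  numEdges G * (n * n) + 4 * (n ∸ 1)           ≡⟨ cong (λ m → m * (n * n) + 4 * (n ∸ 1)) numEdges≡1+n ⟩
  (n * n + n * (n * n)) + 4 * (n ∸ 1)          ≡⟨ swap (n * n) (n * (n * n)) (4 * (n ∸ 1)) ⟩
  n * (n * n) + 4 * (n ∸ 1) + n * n            ∎)
  where
  open ≤-Reasoning
  swap : ∀ a b c → a + b + c ≡ b + c + a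
  swap = solve-∀

-- The cycle on 0, …, m - 1

module Cycle (m : ℕ) (m≥2 : 2 ≤ m) where

  m>0 : 0 < m
  m>0 = ≤-trans (s≤s z≤n) m≥2

  instance
    m-nonZero : NonZero m
    m-nonZero = >-nonZero m>0

  1+[m∸1]≡m : suc (m ∸ 1) ≡ m
  1+[m∸1]≡m = trans (+-comm 1 (m ∸ 1)) (m∸n+n≡m m>0)

  m∸1<m : m ∸ 1 < m
  m∸1<m = subst (m ∸ 1 <_) 1+[m∸1]≡m ≤-refl

  m∸x≡1+m∸1+x : ∀ {x} → x < m → m ∸ x ≡ suc (m ∸ suc x)
  m∸x≡1+m∸1+x x<m = +-∸-assoc 1 x<m

  [a%m+b]%m : ∀ a b → (a % m + b) % m ≡ (a + b) % m
  [a%m+b]%m a b = begin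
    (a % m + b) % m          ≡⟨ %-distribˡ-+ (a % m) b m ⟩
    (a % m % m + b % m) % m  ≡⟨ cong (λ z → (z + b % m) % m) (m%n%n≡m%n a m) ⟩
    (a % m + b % m) % m      ≡⟨ %-distribˡ-+ a b m ⟨
    (a + b) % m              ∎
    where open ≡-Reasoning

  [a+b%m]%m : ∀ a b → (a + b % m) % m ≡ (a + b) % m
  [a+b%m]%m a b = trans (cong (_% m) (+-comm a (b % m))) (trans ([a%m+b]%m b a) (cong (_% m) (+-comm b a)))

  next : ℕ → ℕ
  next x = suc x % m

  next<m : ∀ x → next x < m
  next<m x = m%n<n (suc x) m

  next-% : ∀ a → next (a % m) ≡ suc a % m
  next-% a = [a+b%m]%m 1 a

  next-suc : ∀ {x} → suc x < m → next x ≡ suc x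
  next-suc = m<n⇒m%n≡m

  next-last : ∀ {x} → suc x ≡ m → next x ≡ 0
  next-last 1+x≡m = trans (cong (_% m) 1+x≡m) (n%n≡0 m)

  next-cases : ∀ {x} → x < m → (suc x < m × next x ≡ suc x) ⊎ (suc x ≡ m × next x ≡ 0)
  next-cases x<m with m≤n⇒m<n∨m≡n x<m
  ... | inj₁ 1+x<m = inj₁ (1+x<m , next-suc 1+x<m)
  ... | inj₂ 1+x≡m = inj₂ (1+x≡m , next-last 1+x≡m)

  next-0 : next 0 ≡ 1
  next-0 = next-suc m≥2

  next-[m∸1] : next (m ∸ 1) ≡ 0
  next-[m∸1] = next-last 1+[m∸1]≡m

  next≢ : ∀ {x} → x < m → ¬ next x ≡ x
  next≢ x<m e with next-cases x<m
  ... | inj₁ (_ , next≡1+x) = <⇒≢ (n<1+n _) (sym (trans (sym next≡1+x) e))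
  ... | inj₂ (1+x≡m , next≡0) = <⇒≢ m≥2 (sym (trans (sym 1+x≡m) (cong suc (trans (sym e) next≡0))))

  next≡suc⇒≡ : ∀ {y j} → y < m → next y ≡ suc j → y ≡ j
  next≡suc⇒≡ y<m e with next-cases y<m
  ... | inj₁ (_ , next≡1+y) = suc-injective (trans (sym next≡1+y) e)
  ... | inj₂ (_ , next≡0) with trans (sym next≡0) e
  ...   | ()

  -- offset p x is the number of steps from p forwards to x around the cycle.
  offset : ℕ → ℕ → ℕ
  offset p x = (x + (m ∸ p)) % m

  offset<m : ∀ p x → offset p x < m
  offset<m p x = m%n<n (x + (m ∸ p)) m

  offset-self : ∀ {p} → p < m → offset p p ≡ 0
  offset-self p<m = trans (cong (_% m) (m+[n∸m]≡n (<⇒≤ p<m))) (n%n≡0 m)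

  offset-nextʳ : ∀ p x → offset p (next x) ≡ next (offset p x)
  offset-nextʳ p x = trans ([a%m+b]%m (suc x) (m ∸ p)) (sym (next-% (x + (m ∸ p))))

  offset-nextˡ : ∀ {x} → x < m → ∀ p → offset x p ≡ next (offset (next x) p)
  offset-nextˡ {x} x<m p = sym (begin
    next (offset (next x) p)        ≡⟨ next-% (p + (m ∸ next x)) ⟩
    suc (p + (m ∸ next x)) % m      ≡⟨ cong (_% m) (sym (+-suc p (m ∸ next x))) ⟩
    (p + suc (m ∸ next x)) % m      ≡⟨ wrap (next-cases x<m) ⟩
    (p + (m ∸ x)) % m               ∎)
    where
    open ≡-Reasoning
    wrap : (suc x < m × next x ≡ suc x) ⊎ (suc x ≡ m × next x ≡ 0) →
           (p + suc (m ∸ next x)) % m ≡ (p + (m ∸ x)) % m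
    wrap (inj₁ (_ , next≡1+x)) rewrite next≡1+x = cong (λ z → (p + z) % m) (sym (m∸x≡1+m∸1+x x<m))
    wrap (inj₂ (1+x≡m , next≡0)) = begin
      (p + suc (m ∸ next x)) % m  ≡⟨ cong (λ z → (p + suc (m ∸ z)) % m) next≡0 ⟩
      (p + suc m) % m             ≡⟨ cong (_% m) (regroup p m) ⟩
      (p + 1 + m) % m             ≡⟨ [m+n]%n≡m%n (p + 1) m ⟩
      (p + 1) % m                 ≡⟨ cong (λ z → (p + z) % m) m∸x≡1 ⟨
      (p + (m ∸ x)) % m           ∎
      where
      regroup : ∀ p m → p + suc m ≡ p + 1 + m
      regroup = solve-∀
      m∸x≡1 : m ∸ x ≡ 1
      m∸x≡1 = trans (cong (_∸ x) (trans (sym 1+x≡m) (+-comm 1 x))) (m+n∸m≡n x 1)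

  p+offset : ∀ {p x} → p ≤ m → x < m → (p + offset p x) % m ≡ x
  p+offset {p} {x} p≤m x<m = begin
    (p + (x + (m ∸ p)) % m) % m   ≡⟨ [a+b%m]%m p (x + (m ∸ p)) ⟩
    (p + (x + (m ∸ p))) % m       ≡⟨ cong (_% m) (x+[y+z]≡y+[x+z] p x (m ∸ p)) ⟩
    (x + (p + (m ∸ p))) % m       ≡⟨ cong (λ z → (x + z) % m) (m+[n∸m]≡n p≤m) ⟩
    (x + m) % m                   ≡⟨ [m+n]%n≡m%n x m ⟩
    x % m                         ≡⟨ m<n⇒m%n≡m x<m ⟩
    x                             ∎
    where
    open ≡-Reasoning
    x+[y+z]≡y+[x+z] : ∀ x y z → x + (y + z) ≡ y + (x + z)
    x+[y+z]≡y+[x+z] = solve-∀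

  offset≡0⇒≡ : ∀ {p x} → p < m → x < m → offset p x ≡ 0 → x ≡ p
  offset≡0⇒≡ {p} p<m x<m e =
    trans (sym (p+offset (<⇒≤ p<m) x<m))
          (trans (cong (λ z → (p + z) % m) e) (trans (cong (_% m) (+-identityʳ p)) (m<n⇒m%n≡m p<m)))

  offsetʳ-surjective : ∀ {j p} → j < m → p < m → ∃ λ x → x < m × offset p x ≡ j
  offsetʳ-surjective {j} {p} j<m p<m = (p + j) % m , m%n<n (p + j) m , (begin
    ((p + j) % m + (m ∸ p)) % m   ≡⟨ [a%m+b]%m (p + j) (m ∸ p) ⟩
    (p + j + (m ∸ p)) % m         ≡⟨ cong (_% m) (regroup p j (m ∸ p)) ⟩
    (j + (p + (m ∸ p))) % m       ≡⟨ cong (λ z → (j + z) % m) (m+[n∸m]≡n (<⇒≤ p<m)) ⟩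
    (j + m) % m                   ≡⟨ [m+n]%n≡m%n j m ⟩
    j % m                         ≡⟨ m<n⇒m%n≡m j<m ⟩
    j                             ∎)
    where
    open ≡-Reasoning
    regroup : ∀ p j z → p + j + z ≡ j + (p + z)
    regroup = solve-∀

  offsetˡ-surjective : ∀ {j p} → j < m → p < m → ∃ λ x → x < m × offset x p ≡ j
  offsetˡ-surjective {j} {p} j<m p<m = x , offset<m j p , (begin
    (p + (m ∸ x)) % m               ≡⟨ cong (λ z → (z + (m ∸ x)) % m) (p+offset (<⇒≤ j<m) p<m) ⟨
    ((j + x) % m + (m ∸ x)) % m     ≡⟨ [a%m+b]%m (j + x) (m ∸ x) ⟩
    (j + x + (m ∸ x)) % m           ≡⟨ cong (_% m) (+-assoc j x (m ∸ x)) ⟩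
    (j + (x + (m ∸ x))) % m         ≡⟨ cong (λ z → (j + z) % m) (m+[n∸m]≡n (<⇒≤ (offset<m j p))) ⟩
    (j + m) % m                     ≡⟨ [m+n]%n≡m%n j m ⟩
    j % m                           ≡⟨ m<n⇒m%n≡m j<m ⟩
    j                               ∎)
    where
    open ≡-Reasoning
    x : ℕ
    x = offset j p

  prev-exists : ∀ {q} → q < m → ∃ λ q′ → q′ < m × next q′ ≡ q
  prev-exists {q} q<m = offset 1 q , offset<m 1 q , (begin
    next ((q + (m ∸ 1)) % m)   ≡⟨ next-% (q + (m ∸ 1)) ⟩
    suc (q + (m ∸ 1)) % m      ≡⟨ cong (_% m) (trans (sym (+-suc q (m ∸ 1))) (cong (q +_) 1+[m∸1]≡m)) ⟩
    (q + m) % m                ≡⟨ [m+n]%n≡m%n q m ⟩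
    q % m                      ≡⟨ m<n⇒m%n≡m q<m ⟩
    q                          ∎)
    where open ≡-Reasoning

  cdist : ℕ → ℕ
  cdist f = f ⊓ (m ∸ f)

  cdist≤ : ∀ f → cdist f ≤ f
  cdist≤ f = m⊓n≤m f (m ∸ f)

  cdist-small : ∀ {k} → k + k ≤ m → cdist k ≡ k
  cdist-small {k} 2k≤m = m≤n⇒m⊓n≡m (subst (_≤ m ∸ k) (m+n∸m≡n k k) (∸-monoˡ-≤ k 2k≤m))

  cdist-next : ∀ {f} → f < m → cdist (next f) ≤ suc (cdist f) × cdist f ≤ suc (cdist (next f))
  cdist-next {f} f<m with next-cases f<m
  ... | inj₂ (1+f≡m , next≡0) rewrite next≡0 =
    z≤n , ≤-trans (m⊓n≤n f (m ∸ f)) (≤-reflexive (trans (cong (_∸ f) (trans (sym 1+f≡m) (+-comm 1 f))) (m+n∸m≡n f 1)))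
  ... | inj₁ (_ , next≡1+f) rewrite next≡1+f | m∸x≡1+m∸1+x f<m =
    ⊓-monoʳ-≤ (suc f) (≤-trans (n≤1+n (m ∸ suc f)) (n≤1+n _)) ,
    ⊓-monoˡ-≤ (suc (m ∸ suc f)) (≤-trans (n≤1+n f) (n≤1+n _))

-- The graph B (m + 1)

module TwinCycle (m : ℕ) (m≥5 : 5 ≤ m) where
  m≥2 : 2 ≤ m
  m≥2 = ≤-trans (s≤s (s≤s z≤n)) m≥5

  2<m : 2 < m
  2<m = ≤-trans (s≤s (s≤s (s≤s z≤n))) m≥5

  open Cycle m m≥2 public
  open Reachability (B (suc m))

  -- π projects B onto the cycle C_m on 0, …, m - 1, sending the twin m to 0, the vertex it duplicates.
  πℕ : ℕ → ℕ
  πℕ a = if a <ᵇ m then a else 0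

  πℕ-< : ∀ {a} → a < m → πℕ a ≡ a
  πℕ-< lt rewrite <⇒<ᵇ-true lt = refl

  πℕ-m : πℕ m ≡ 0
  πℕ-m rewrite ≮⇒<ᵇ-false {m} {m} (<-irrefl refl) = refl

  πℕ<m : ∀ a → πℕ a < m
  πℕ<m a with a <ᵇ m in e
  ... | true = <ᵇ-true⇒< e
  ... | false = m>0

  π : Fin (suc m) → ℕ
  π w = πℕ (toℕ w)

  π<m : ∀ w → π w < m
  π<m w = πℕ<m (toℕ w)

  <1+m-cases : ∀ a → a < suc m → a < m ⊎ a ≡ m
  <1+m-cases a (s≤s le) with m≤n⇒m<n∨m≡n le
  ... | inj₁ lt = inj₁ lt
  ... | inj₂ eq = inj₂ eq

  m≢1 : ¬ m ≡ 1
  m≢1 e = <⇒≢ m≥2 (sym e)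

  m≢m∸1 : ¬ m ≡ m ∸ 1
  m≢m∸1 e = <⇒≢ m∸1<m (sym e)

  adjℕ⇒next : ∀ a b → a < suc m → b < suc m → BAdjℕ (suc m) a b ≡ true → πℕ b ≡ next (πℕ a) ⊎ πℕ a ≡ next (πℕ b)
  adjℕ⇒next a b am' bm' h with <1+m-cases a am' | <1+m-cases b bm'
  ... | inj₁ am | inj₁ bm with a <ᵇ m | <⇒<ᵇ-true am | b <ᵇ m | <⇒<ᵇ-true bm
  ... | .true | refl | .true | refl with ∨-true⁻ h
  ... | inj₁ e1 = inj₁ (trans (sym (≡ᵇ-true⇒≡ e1)) (sym (next-suc (subst (_< m) (sym (≡ᵇ-true⇒≡ e1)) bm))))
  ... | inj₂ h2 with ∨-true⁻ h2
  ... | inj₁ e1 = inj₂ (trans (sym (≡ᵇ-true⇒≡ e1)) (sym (next-suc (subst (_< m) (sym (≡ᵇ-true⇒≡ e1)) am))))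
  ... | inj₂ h3 with ∨-true⁻ h3
  ... | inj₁ e1 = inj₂ (trans (≡ᵇ-true⇒≡ (proj₁ (∧-true⁻ e1)))
                         (sym (trans (cong next (≡ᵇ-true⇒≡ (proj₂ (∧-true⁻ e1)))) next-[m∸1])))
  ... | inj₂ e1 = inj₁ (trans (≡ᵇ-true⇒≡ (proj₁ (∧-true⁻ e1)))
                         (sym (trans (cong next (≡ᵇ-true⇒≡ (proj₂ (∧-true⁻ e1)))) next-[m∸1])))
  adjℕ⇒next a .m am' bm' h | inj₁ am | inj₂ refl with a <ᵇ m | <⇒<ᵇ-true am | m <ᵇ m | ≮⇒<ᵇ-false {m} {m} (<-irrefl refl)
  ... | .true | refl | .false | refl with ∨-true⁻ h
  ... | inj₁ e1 = ⊥-elim (<⇒≢ am (≡ᵇ-true⇒≡ (proj₁ (∧-true⁻ e1))))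
  ... | inj₂ e1 with ∨-true⁻ (proj₂ (∧-true⁻ e1))
  ... | inj₁ e = inj₂ (trans (≡ᵇ-true⇒≡ e) (sym next-0))
  ... | inj₂ e = inj₁ (sym (trans (cong next (≡ᵇ-true⇒≡ e)) next-[m∸1]))
  adjℕ⇒next .m b am' bm' h | inj₂ refl | inj₁ bm with m <ᵇ m | ≮⇒<ᵇ-false {m} {m} (<-irrefl refl) | b <ᵇ m | <⇒<ᵇ-true bm
  ... | .false | refl | .true | refl with ∨-true⁻ h
  ... | inj₂ e1 = ⊥-elim (<⇒≢ bm (≡ᵇ-true⇒≡ (proj₁ (∧-true⁻ e1))))
  ... | inj₁ e1 with ∨-true⁻ (proj₂ (∧-true⁻ e1))
  ... | inj₁ e = inj₁ (trans (≡ᵇ-true⇒≡ e) (sym next-0))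
  ... | inj₂ e = inj₂ (sym (trans (cong next (≡ᵇ-true⇒≡ e)) next-[m∸1]))
  adjℕ⇒next .m .m am' bm' h | inj₂ refl | inj₂ refl with m <ᵇ m | ≮⇒<ᵇ-false {m} {m} (<-irrefl refl)
  ... | .false | refl with ∨-true⁻ {(m ≡ᵇ m) ∧ ((m ≡ᵇ 1) ∨ (m ≡ᵇ m ∸ 1))} h
  ... | inj₁ e1 with ∨-true⁻ (proj₂ (∧-true⁻ {m ≡ᵇ m} e1))
  ... | inj₁ e = ⊥-elim (m≢1 (≡ᵇ-true⇒≡ e))
  ... | inj₂ e = ⊥-elim (m≢m∸1 (≡ᵇ-true⇒≡ e))
  adjℕ⇒next .m .m am' bm' h | inj₂ refl | inj₂ refl | .false | refl | inj₂ e1 with ∨-true⁻ (proj₂ (∧-true⁻ {m ≡ᵇ m} e1))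
  ... | inj₁ e = ⊥-elim (m≢1 (≡ᵇ-true⇒≡ e))
  ... | inj₂ e = ⊥-elim (m≢m∸1 (≡ᵇ-true⇒≡ e))

  Bₘ₊₁ : Graph (suc m)
  Bₘ₊₁ = B (suc m)

  adj⇒next : ∀ i j → adj Bₘ₊₁ i j ≡ true → π j ≡ next (π i) ⊎ π i ≡ next (π j)
  adj⇒next i j h with ∨-true⁻ (proj₂ (∧-true⁻ {not (i == j)} h))
  ... | inj₁ r = adjℕ⇒next (toℕ i) (toℕ j) (toℕ<n i) (toℕ<n j) r
  ... | inj₂ r with adjℕ⇒next (toℕ j) (toℕ i) (toℕ<n j) (toℕ<n i) r
  ... | inj₁ x = inj₂ x
  ... | inj₂ y = inj₁ y

  next⇒adjℕ : ∀ a b → a < suc m → b < suc m → πℕ b ≡ next (πℕ a) → BAdjℕ (suc m) a b ≡ true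
  next⇒adjℕ a b am' bm' e with <1+m-cases a am' | <1+m-cases b bm'
  ... | inj₁ am | inj₁ bm with a <ᵇ m | <⇒<ᵇ-true am | b <ᵇ m | <⇒<ᵇ-true bm
  ... | .true | refl | .true | refl with next-cases am
  ... | inj₁ (_ , s) = ∨-trueˡ _ (≡⇒≡ᵇ-true (sym (trans e s)))
  ... | inj₂ (ea , s) = ∨-trueʳ (suc a ≡ᵇ b) (∨-trueʳ (suc b ≡ᵇ a) (∨-trueʳ ((a ≡ᵇ 0) ∧ (b ≡ᵇ m ∸ 1))
          (∧-true⁺ (≡⇒≡ᵇ-true (trans e s)) (≡⇒≡ᵇ-true (cong (_∸ 1) ea)))))
  next⇒adjℕ a .m am' bm' e | inj₁ am | inj₂ refl with a <ᵇ m | <⇒<ᵇ-true am | m <ᵇ m | ≮⇒<ᵇ-false {m} {m} (<-irrefl refl)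
  ... | .true | refl | .false | refl with next-cases am
  ... | inj₁ (_ , s) with trans e s
  ... | ()
  next⇒adjℕ a .m am' bm' e | inj₁ am | inj₂ refl | .true | refl | .false | refl | inj₂ (ea , s) =
      ∨-trueʳ ((a ≡ᵇ m) ∧ ((m ≡ᵇ 1) ∨ (m ≡ᵇ m ∸ 1)))
        (∧-true⁺ (≡ᵇ-refl m) (∨-trueʳ (a ≡ᵇ 1) (≡⇒≡ᵇ-true (cong (_∸ 1) ea))))
  next⇒adjℕ .m b am' bm' e | inj₂ refl | inj₁ bm with m <ᵇ m | ≮⇒<ᵇ-false {m} {m} (<-irrefl refl) | b <ᵇ m | <⇒<ᵇ-true bm
  ... | .false | refl | .true | refl = ∨-trueˡ _ (∧-true⁺ (≡ᵇ-refl m) (∨-trueˡ _ (≡⇒≡ᵇ-true (trans e next-0))))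
  next⇒adjℕ .m .m am' bm' e | inj₂ refl | inj₂ refl with m <ᵇ m | ≮⇒<ᵇ-false {m} {m} (<-irrefl refl)
  ... | .false | refl with trans e next-0
  ... | ()

  next⇒adj : ∀ w w' → π w' ≡ next (π w) → adj Bₘ₊₁ w w' ≡ true
  next⇒adj w w' e with toℕ w ≡ᵇ toℕ w' in eq
  ... | true = ⊥-elim (next≢ (π<m w) (sym (trans (cong πℕ (≡ᵇ-true⇒≡ eq)) e)))
  ... | false = ∨-trueˡ _ (next⇒adjℕ (toℕ w) (toℕ w') (toℕ<n w) (toℕ<n w') e)

  lift : ∀ x → x < m → Fin (suc m)
  lift x xm = fromℕ< (m<n⇒m<1+n xm)

  π-lift : ∀ x (xm : x < m) → π (lift x xm) ≡ x
  π-lift x xm = trans (cong πℕ (toℕ-fromℕ< (m<n⇒m<1+n xm))) (πℕ-< xm)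

  step-behind : ∀ {x p j} → x < m → p < m → offset x p ≡ suc j → offset (next x) p ≡ j
  step-behind {x} {p} xm pm e = next≡suc⇒≡ (offset<m (next x) p) (trans (sym (offset-nextˡ xm p)) e)

  step-ahead : ∀ {p q x j} → p < m → q < m → next q ≡ x → offset p x ≡ suc j → offset p q ≡ j
  step-ahead {p} {q} pm qm refl e = next≡suc⇒≡ (offset<m p q) (trans (sym (offset-nextʳ p q)) e)

  reach-behind : ∀ u j w → offset (π w) (π u) ≡ suc j → reach Bₘ₊₁ (suc j) u w ≡ true
  reach-behind u zero w e =
    reach-step 0 {u} {u} {w} (reach-refl 0 u) (trans (Graph.sym Bₘ₊₁ u w) (next⇒adj w u πu≡next))
    where
    πu≡next : π u ≡ next (π w)
    πu≡next = offset≡0⇒≡ (next<m (π w)) (π<m u) (step-behind (π<m w) (π<m u) e)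
  reach-behind u (suc j) w e =
    reach-step (suc j) {u} {w′} {w} (reach-behind u j w′ e′) (trans (Graph.sym Bₘ₊₁ w′ w) (next⇒adj w w′ πw′))
    where
    w′ : Fin (suc m)
    w′ = lift (next (π w)) (next<m (π w))
    πw′ : π w′ ≡ next (π w)
    πw′ = π-lift _ (next<m (π w))
    e′ : offset (π w′) (π u) ≡ suc j
    e′ = trans (cong (λ z → offset z (π u)) πw′) (step-behind (π<m w) (π<m u) e)

  reach-ahead : ∀ u j w → offset (π u) (π w) ≡ suc j → reach Bₘ₊₁ (suc j) u w ≡ true
  reach-ahead u j w e with prev-exists (π<m w)
  reach-ahead u zero w e | q , q<m , next-q =
    reach-step 0 {u} {u} {w} (reach-refl 0 u) (next⇒adj u w (trans (sym next-q) (cong next q≡πu)))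
    where
    q≡πu : q ≡ π u
    q≡πu = offset≡0⇒≡ (π<m u) q<m (step-ahead (π<m u) q<m next-q e)
  reach-ahead u (suc j) w e | q , q<m , next-q =
    reach-step (suc j) {u} {w′} {w} (reach-ahead u j w′ e′) (next⇒adj w′ w (trans (sym next-q) (cong next (sym πw′))))
    where
    w′ : Fin (suc m)
    w′ = lift q q<m
    πw′ : π w′ ≡ q
    πw′ = π-lift q q<m
    e′ : offset (π u) (π w′) ≡ suc j
    e′ = trans (cong (offset (π u)) πw′) (step-ahead (π<m u) q<m next-q e)

  -- Offset 0 does not force distance 0: the twin and 0 are at distance 2.
  dist-behind≤ : ∀ {u w j} → offset (π w) (π u) ≡ j → (w ≡ u ⊎ 0 < j) → j < suc m → dist Bₘ₊₁ u w ≤ j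
  dist-behind≤ {u} {j = j} _ (inj₁ refl) j<n = dist≤ (reach-refl j u) j<n
  dist-behind≤ {j = suc j} e (inj₂ _) j<n = dist≤ (reach-behind _ j _ e) j<n

  dist-ahead≤ : ∀ {u w j} → offset (π u) (π w) ≡ j → (w ≡ u ⊎ 0 < j) → j < suc m → dist Bₘ₊₁ u w ≤ j
  dist-ahead≤ {u} {j = j} _ (inj₁ refl) j<n = dist≤ (reach-refl j u) j<n
  dist-ahead≤ {j = suc j} e (inj₂ _) j<n = dist≤ (reach-ahead _ j _ e) j<n

  -- Both are the cyclic distance between π u and π w; the two orientations of the offset let the
  -- Lipschitz proofs use offset-nextˡ and offset-nextʳ respectively.
  cdistBehind cdistAhead : Fin (suc m) → Fin (suc m) → ℕ
  cdistBehind u w = cdist (offset (π w) (π u))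
  cdistAhead  u w = cdist (offset (π u) (π w))

  cdistBehind-lipschitz : ∀ u → Lipschitz Bₘ₊₁ (cdistBehind u)
  cdistBehind-lipschitz u x y a with adj⇒next x y a
  ... | inj₁ πy≡ = subst (λ z → cdist (offset (π y) (π u)) ≤ suc (cdist z))
                     (sym (trans (offset-nextˡ (π<m x) (π u)) (cong (λ z → next (offset z (π u))) (sym πy≡))))
                     (proj₂ (cdist-next (offset<m (π y) (π u))))
  ... | inj₂ πx≡ = subst (λ z → cdist z ≤ suc (cdist (offset (π x) (π u))))
                     (sym (trans (offset-nextˡ (π<m y) (π u)) (cong (λ z → next (offset z (π u))) (sym πx≡))))
                     (proj₁ (cdist-next (offset<m (π x) (π u))))

  cdistAhead-lipschitz : ∀ u → Lipschitz Bₘ₊₁ (cdistAhead u)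
  cdistAhead-lipschitz u x y a with adj⇒next x y a
  ... | inj₁ πy≡ = subst (λ z → cdist z ≤ suc (cdist (offset (π u) (π x))))
                     (sym (trans (cong (offset (π u)) πy≡) (offset-nextʳ (π u) (π x))))
                     (proj₁ (cdist-next (offset<m (π u) (π x))))
  ... | inj₂ πx≡ = subst (λ z → cdist (offset (π u) (π y)) ≤ suc (cdist z))
                     (sym (trans (cong (offset (π u)) πx≡) (offset-nextʳ (π u) (π y))))
                     (proj₂ (cdist-next (offset<m (π u) (π y))))

  behind⇒≤dist : ∀ {u w k} → offset (π w) (π u) ≡ k → k + k ≤ m → k ≤ dist Bₘ₊₁ u w
  behind⇒≤dist {u} {w} {k} e 2k≤m = subst (_≤ dist Bₘ₊₁ u w) (trans (cong cdist e) (cdist-small 2k≤m))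
    (lipschitz⇒≤dist (cdistBehind-lipschitz u) (cong cdist (offset-self (π<m u)))
      (≤-trans (cdist≤ _) (≤-trans (<⇒≤ (offset<m (π w) (π u))) (n≤1+n m))))

  ahead⇒≤dist : ∀ {u w k} → offset (π u) (π w) ≡ k → k + k ≤ m → k ≤ dist Bₘ₊₁ u w
  ahead⇒≤dist {u} {w} {k} e 2k≤m = subst (_≤ dist Bₘ₊₁ u w) (trans (cong cdist e) (cdist-small 2k≤m))
    (lipschitz⇒≤dist (cdistAhead-lipschitz u) (cong cdist (offset-self (π<m u)))
      (≤-trans (cdist≤ _) (≤-trans (<⇒≤ (offset<m (π u) (π w))) (n≤1+n m))))

  2[1+j]≤m⇒j<m : ∀ {j} → suc j + suc j ≤ m → suc j < m
  2[1+j]≤m⇒j<m {j} le = ≤-trans (s≤s (s≤s (m≤n+m j j))) (subst (_≤ m) (+-suc (suc j) j) le)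

  closer-behind : ∀ {u v} → π v ≡ next (π u) → ∀ {w j} → offset (π w) (π u) ≡ j → suc j + suc j ≤ m →
    (w ≡ u ⊎ 0 < j) → (dist Bₘ₊₁ u w <ᵇ dist Bₘ₊₁ v w) ≡ true
  closer-behind {u} {v} πv≡ {w} {j} e le side = <⇒<ᵇ-true (≤-trans (s≤s (dist-behind≤ e side j<n)) (behind⇒≤dist e′ le))
    where
    j<n : j < suc m
    j<n = <-trans (n<1+n j) (<-trans (2[1+j]≤m⇒j<m le) (n<1+n m))
    e′ : offset (π w) (π v) ≡ suc j
    e′ = trans (cong (offset (π w)) πv≡) (trans (offset-nextʳ (π w) (π u)) (trans (cong next e) (next-suc (2[1+j]≤m⇒j<m le))))

  closer-ahead : ∀ {u v} → π v ≡ next (π u) → ∀ {w j} → offset (π v) (π w) ≡ j → suc j + suc j ≤ m →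
    (w ≡ v ⊎ 0 < j) → (dist Bₘ₊₁ v w <ᵇ dist Bₘ₊₁ u w) ≡ true
  closer-ahead {u} {v} πv≡ {w} {j} e le side = <⇒<ᵇ-true (≤-trans (s≤s (dist-ahead≤ e side j<n)) (ahead⇒≤dist e′ le))
    where
    j<n : j < suc m
    j<n = <-trans (n<1+n j) (<-trans (2[1+j]≤m⇒j<m le) (n<1+n m))
    e′ : offset (π u) (π w) ≡ suc j
    e′ = trans (offset-nextˡ (π<m u) (π w)) (trans (cong (λ z → next (offset z (π w))) (sym πv≡))
                 (trans (cong next e) (next-suc (2[1+j]≤m⇒j<m le))))

  -- a itself and, F being onto, one vertex at each offset 1, …, h.
  closer-count : ∀ {a b} (F : Fin (suc m) → ℕ) → (∀ {j} → j < m → ∃ λ w → F w ≡ j) → F a ≡ 0 →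
    (∀ {w j} → F w ≡ j → suc j + suc j ≤ m → (w ≡ a ⊎ 0 < j) → (dist Bₘ₊₁ a w <ᵇ dist Bₘ₊₁ b w) ≡ true) →
    ∀ {h} → suc h + suc h ≤ m → suc h ≤ nU Bₘ₊₁ a b
  closer-count {a} {b} F onto Fa≡0 closer {h} le = begin
    suc h
      ≤⟨ +-mono-≤ (≤-reflexive (sym (∑-𝟙-== (suc m) a)))
                  (∑-𝟙-inRange≥ (suc m) F h (λ j≤h → onto (≤-<-trans j≤h h<m))) ⟩
    ∑ (suc m) (λ w → 𝟙 (w == a)) + ∑ (suc m) (𝟙 ∘ inRange h ∘ F)
      ≡⟨ ∑-distrib-+ (suc m) (λ w → 𝟙 (w == a)) (𝟙 ∘ inRange h ∘ F) ⟨
    ∑ (suc m) (λ w → 𝟙 (w == a) + 𝟙 (inRange h (F w)))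
      ≤⟨ ∑-mono-≤ (suc m) counted⇒closer ⟩
    ∑ (suc m) (𝟙 ∘ closer-to-a)
      ≡⟨ count≡∑ closer-to-a ⟨
    nU Bₘ₊₁ a b
      ∎
    where
    open ≤-Reasoning
    closer-to-a : Fin (suc m) → Bool
    closer-to-a w = dist Bₘ₊₁ a w <ᵇ dist Bₘ₊₁ b w
    h<m : h < m
    h<m = <-trans (n<1+n h) (2[1+j]≤m⇒j<m le)
    small : ∀ {f} → f ≤ h → suc f + suc f ≤ m
    small f≤h = ≤-trans (+-mono-≤ (s≤s f≤h) (s≤s f≤h)) le
    counted⇒closer : ∀ w → 𝟙 (w == a) + 𝟙 (inRange h (F w)) ≤ 𝟙 (closer-to-a w)
    counted⇒closer w with inRange h (F w) in e
    ... | true rewrite closer refl (small (proj₂ (inRange⇒ e))) (inj₂ (proj₁ (inRange⇒ e)))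
                     | ≢⇒==-false {u = w} {a} (λ { refl → <⇒≢ (proj₁ (inRange⇒ e)) (sym Fa≡0) }) = ≤-refl
    ... | false with w == a in e′
    ...   | false = z≤n
    ...   | true rewrite ==⇒≡ {u = w} e′ | closer Fa≡0 (small z≤n) (inj₁ refl) = ≤-refl

  nU-lower : ∀ {u v} → π v ≡ next (π u) → ∀ {h} → suc h + suc h ≤ m → suc h ≤ nU Bₘ₊₁ u v
  nU-lower {u} {v} πv≡ = closer-count {u} {v} (λ w → offset (π w) (π u)) onto (offset-self (π<m u)) (closer-behind πv≡)
    where
    onto : ∀ {j} → j < m → ∃ λ w → offset (π w) (π u) ≡ j
    onto j<m with offsetˡ-surjective j<m (π<m u)
    ... | x , x<m , e = lift x x<m , trans (cong (λ z → offset z (π u)) (π-lift x x<m)) e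

  nV-lower : ∀ {u v} → π v ≡ next (π u) → ∀ {h} → suc h + suc h ≤ m → suc h ≤ nU Bₘ₊₁ v u
  nV-lower {u} {v} πv≡ = closer-count {v} {u} (λ w → offset (π v) (π w)) onto (offset-self (π<m v)) (closer-ahead πv≡)
    where
    onto : ∀ {j} → j < m → ∃ λ w → offset (π v) (π w) ≡ j
    onto j<m with offsetʳ-surjective j<m (π<m v)
    ... | x , x<m , e = lift x x<m , trans (cong (offset (π v)) (π-lift x x<m)) e

  B-weight-lower : ∀ {u v} → adj Bₘ₊₁ u v ≡ true → ∀ {h} → suc h + suc h ≤ m →
    4 * suc h * (suc m ∸ suc h) ≤ weight Bₘ₊₁ (u , v)
  B-weight-lower {u} {v} a le with adj⇒next u v a
  ... | inj₁ πv≡ = 4k[n∸k]≤[2a+c][2b+c] (nU-lower πv≡ le) (nV-lower πv≡ le) (nU+nU+n0≡n Bₘ₊₁ u v)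
  ... | inj₂ πu≡ = 4k[n∸k]≤[2a+c][2b+c] (nV-lower πu≡ le) (nU-lower πu≡ le) (nU+nU+n0≡n Bₘ₊₁ u v)

  higherNeighbours : Fin (suc m) → ℕ
  higherNeighbours u = ∑ (suc m) (𝟙 ∘ upEdge Bₘ₊₁ u)

  one-higher : ∀ {u v} → toℕ u < toℕ v → adj Bₘ₊₁ u v ≡ true → 1 ≤ higherNeighbours u
  one-higher {u} {v} u<v a =
    subst (_≤ higherNeighbours u) (𝟙-upEdge Bₘ₊₁ u<v a) (∑-point (suc m) (𝟙 ∘ upEdge Bₘ₊₁ u) v)

  two-higher : ∀ {u v w} → ¬ v ≡ w → toℕ u < toℕ v → adj Bₘ₊₁ u v ≡ true →
    toℕ u < toℕ w → adj Bₘ₊₁ u w ≡ true → 2 ≤ higherNeighbours u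
  two-higher {u} v≢w u<v av u<w aw =
    subst (_≤ higherNeighbours u) (cong₂ _+_ (𝟙-upEdge Bₘ₊₁ u<v av) (𝟙-upEdge Bₘ₊₁ u<w aw))
      (∑-two-points (suc m) (𝟙 ∘ upEdge Bₘ₊₁ u) v≢w)

  twin : Fin (suc m)
  twin = fromℕ< (n<1+n m)

  toℕ-twin : toℕ twin ≡ m
  toℕ-twin = toℕ-fromℕ< (n<1+n m)

  π-twin : π twin ≡ 0
  π-twin = trans (cong πℕ toℕ-twin) πℕ-m

  up : (u : Fin (suc m)) → toℕ u < m → Fin (suc m)
  up u u<m = fromℕ< (s≤s u<m)

  toℕ-up : ∀ {u} (u<m : toℕ u < m) → toℕ (up u u<m) ≡ suc (toℕ u)
  toℕ-up u<m = toℕ-fromℕ< (s≤s u<m)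

  <-up : ∀ {u} (u<m : toℕ u < m) → toℕ u < toℕ (up u u<m)
  <-up {u} u<m = subst (toℕ u <_) (sym (toℕ-up u<m)) (n<1+n (toℕ u))

  adj-up : ∀ {u} (u<m : toℕ u < m) → adj Bₘ₊₁ u (up u u<m) ≡ true
  adj-up {u} u<m = next⇒adj u (up u u<m) (trans (cong πℕ (toℕ-up u<m)) (sym (trans (cong next (πℕ-< u<m)) next-u)))
    where
    next-u : next (toℕ u) ≡ πℕ (suc (toℕ u))
    next-u with m≤n⇒m<n∨m≡n u<m
    ... | inj₁ 1+u<m = trans (next-suc 1+u<m) (sym (πℕ-< 1+u<m))
    ... | inj₂ 1+u≡m = trans (next-last 1+u≡m) (sym (trans (cong πℕ 1+u≡m) πℕ-m))

  <2-cases : ∀ {i} → i < 2 → i ≡ 0 ⊎ i ≡ 1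
  <2-cases (s≤s z≤n)       = inj₁ refl
  <2-cases (s≤s (s≤s z≤n)) = inj₂ refl

  second-higher : (u : Fin (suc m)) (u<m : toℕ u < m) → toℕ u < 2 →
    ∃ λ w → ¬ up u u<m ≡ w × toℕ u < toℕ w × adj Bₘ₊₁ u w ≡ true
  second-higher u u<m u<2 with <2-cases u<2
  ... | inj₁ eq = w , up≢w , subst₂ _<_ (sym eq) (sym toℕ-w) (≤-trans (s≤s z≤n) (∸-monoˡ-≤ 1 m≥2))
              , trans (Graph.sym Bₘ₊₁ u w) (next⇒adj w u πu≡)
    where
    w : Fin (suc m)
    w = lift (m ∸ 1) m∸1<m
    toℕ-w : toℕ w ≡ m ∸ 1
    toℕ-w = toℕ-fromℕ< (m<n⇒m<1+n m∸1<m)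
    up≢w : ¬ up u u<m ≡ w
    up≢w e = <⇒≢ (≤-trans (s≤s (s≤s z≤n)) (∸-monoˡ-≤ 1 m≥5))
                  (trans (sym (trans (toℕ-up u<m) (cong suc eq))) (trans (cong toℕ e) toℕ-w))
    πu≡ : π u ≡ next (π w)
    πu≡ = trans (cong πℕ eq) (trans (πℕ-< m>0) (sym (trans (cong next (π-lift (m ∸ 1) m∸1<m)) next-[m∸1])))
  ... | inj₂ eq = twin , up≢twin , subst₂ _<_ (sym eq) (sym toℕ-twin) 1<m
              , trans (Graph.sym Bₘ₊₁ u twin) (next⇒adj twin u πu≡)
    where
    1<m : 1 < m
    1<m = ≤-trans (s≤s (s≤s z≤n)) m≥2
    up≢twin : ¬ up u u<m ≡ twin
    up≢twin e = <⇒≢ 2<m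
                     (trans (sym (trans (toℕ-up u<m) (cong suc eq))) (trans (cong toℕ e) toℕ-twin))
    πu≡ : π u ≡ next (π twin)
    πu≡ = trans (cong πℕ eq) (trans (πℕ-< 1<m) (sym (trans (cong next π-twin) next-0)))

  -- Each cycle vertex has a higher neighbour (the next one, or the twin after m - 1), and 0 and 1
  -- have a second one (m - 1 and the twin).
  higherNeighbours-lower : ∀ u → 𝟙 (toℕ u <ᵇ m) + 𝟙 (toℕ u <ᵇ 2) ≤ higherNeighbours u
  higherNeighbours-lower u with <1+m-cases (toℕ u) (toℕ<n u)
  ... | inj₂ u≡m = ≤-trans (≤-reflexive (cong₂ _+_ (cong 𝟙 (≮⇒<ᵇ-false (<-irrefl u≡m)))
                                                   (cong 𝟙 (≮⇒<ᵇ-false (<⇒≯ (subst (2 <_) (sym u≡m) 2<m))))))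
                           z≤n
  ... | inj₁ u<m with toℕ u <? 2
  ...   | no  u≮2 = ≤-trans (≤-reflexive (cong₂ _+_ (cong 𝟙 (<⇒<ᵇ-true u<m)) (cong 𝟙 (≮⇒<ᵇ-false u≮2))))
                            (one-higher (<-up u<m) (adj-up u<m))
  ...   | yes u<2 with second-higher u u<m u<2
  ...     | w , up≢w , u<w , aw = ≤-trans (≤-reflexive (cong₂ _+_ (cong 𝟙 (<⇒<ᵇ-true u<m)) (cong 𝟙 (<⇒<ᵇ-true u<2))))
                                          (two-higher up≢w (<-up u<m) (adj-up u<m) u<w aw)

  B-numEdges-lower : suc (suc m) ≤ numEdges Bₘ₊₁
  B-numEdges-lower = begin
    suc (suc m)
      ≡⟨ +-comm 2 m ⟩
    m + 2
      ≡⟨ cong₂ _+_ (∑-𝟙-toℕ< (suc m) m (n≤1+n m)) (∑-𝟙-toℕ< (suc m) 2 (≤-trans (<⇒≤ 2<m) (n≤1+n m))) ⟨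
    ∑ (suc m) (λ u → 𝟙 (toℕ u <ᵇ m)) + ∑ (suc m) (λ u → 𝟙 (toℕ u <ᵇ 2))
      ≡⟨ ∑-distrib-+ (suc m) (λ u → 𝟙 (toℕ u <ᵇ m)) (λ u → 𝟙 (toℕ u <ᵇ 2)) ⟨
    ∑ (suc m) (λ u → 𝟙 (toℕ u <ᵇ m) + 𝟙 (toℕ u <ᵇ 2))
      ≤⟨ ∑-mono-≤ (suc m) higherNeighbours-lower ⟩
    ∑ (suc m) higherNeighbours
      ≡⟨ numEdges≡∑ Bₘ₊₁ ⟨
    numEdges Bₘ₊₁
      ∎
    where open ≤-Reasoning

  weights-lower : ∀ {h} → suc h + suc h ≤ m →
    suc (suc m) * (4 * suc h * (suc m ∸ suc h)) ≤ weights Bₘ₊₁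
  weights-lower le = ≤-trans (*-monoˡ-≤ _ B-numEdges-lower)
    (sum-map-≥ (weight Bₘ₊₁) (edges Bₘ₊₁) (λ { {u , v} e∈ → B-weight-lower (∈-edges⁻ Bₘ₊₁ e∈) le }))

B-weights-lower : ∀ k d → k ≤ d → 5 ≤ k + d →
  suc (suc (k + d)) * (4 * k * suc d) ≤ weights (B (suc (k + d)))
B-weights-lower zero    d _ _ = ≤-trans (≤-reflexive (*-zeroʳ (suc (suc d)))) z≤n
B-weights-lower (suc h) d k≤d 5≤m =
  subst (λ x → suc (suc (suc h + d)) * (4 * suc h * x) ≤ weights (B (suc (suc h + d)))) n∸k≡1+d
    (TwinCycle.weights-lower (suc h + d) 5≤m (+-monoʳ-≤ (suc h) k≤d))
  where
  n∸k≡1+d : suc (suc h + d) ∸ suc h ≡ suc d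
  n∸k≡1+d = trans (cong (_∸ suc h) (sym (+-suc (suc h) d))) (m+n∸m≡n (suc h) (suc d))

<-by-slack : ∀ {a b} c → suc a + c ≡ b → a < b
<-by-slack {a} c e = subst (suc a ≤_) e (m≤m+n (suc a) c)

odd-inequality : ∀ k → 3 ≤ k → pendantBound (suc (k + k)) < suc (suc (k + k)) * (4 * k * suc k)
odd-inequality k 3≤k = subst (λ k → pendantBound (suc (k + k)) < suc (suc (k + k)) * (4 * k * suc k))
  (m+[n∸m]≡n 3≤k) (<-by-slack (4 * r * r + 18 * r + 16) (identity r))
  where
  r : ℕ
  r = k ∸ 3
  identity : ∀ r → let n = suc ((3 + r) + (3 + r)) in suc (n * (n * n) + 4 * ((3 + r) + (3 + r))) + (4 * r * r + 18 * r + 16)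
                   ≡ suc (suc ((3 + r) + (3 + r))) * (4 * (3 + r) * suc (3 + r))
  identity = solve-∀

even-inequality : ∀ k → 4 ≤ k → pendantBound (suc (k + suc k)) < suc (suc (k + suc k)) * (4 * k * suc (suc k))
even-inequality k 4≤k = subst (λ k → pendantBound (suc (k + suc k)) < suc (suc (k + suc k)) * (4 * k * suc (suc k)))
  (m+[n∸m]≡n 4≤k) (<-by-slack (4 * r * r + 24 * r + 19) (identity r))
  where
  r : ℕ
  r = k ∸ 4
  identity : ∀ r → let n = suc ((4 + r) + suc (4 + r)) in suc (n * (n * n) + 4 * ((4 + r) + suc (4 + r))) + (4 * r * r + 24 * r + 19)
                   ≡ suc (suc ((4 + r) + suc (4 + r))) * (4 * (4 + r) * suc (suc (4 + r)))
  identity = solve-∀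

parity : ∀ n → ∃ (λ k → n ≡ k + k) ⊎ ∃ (λ k → n ≡ suc (k + k))
parity zero = inj₁ (0 , refl)
parity (suc n) with parity n
... | inj₁ (k , refl) = inj₂ (k , refl)
... | inj₂ (k , refl) = inj₁ (suc k , cong suc (sym (+-suc k k)))

data Order : ℕ → Set where
  six   : Order 6
  eight : Order 8
  odd   : ∀ k → 3 ≤ k → Order (suc (k + k))
  even  : ∀ k → 4 ≤ k → Order (suc (k + suc k))

order : ∀ n → 6 ≤ n → Order n
order (suc n) 6≤n with parity n
... | inj₁ (k , refl) = odd-order k 6≤n
  where
  odd-order : ∀ k → 6 ≤ suc (k + k) → Order (suc (k + k))
  odd-order (suc (suc (suc k))) _ = odd (3 + k) (s≤s (s≤s (s≤s z≤n)))
  odd-order 0 (s≤s ())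
  odd-order 1 (s≤s (s≤s (s≤s ())))
  odd-order 2 (s≤s (s≤s (s≤s (s≤s (s≤s ())))))
... | inj₂ (k , refl) = subst Order (cong suc (+-suc k k)) (even-order k 6≤n)
  where
  even-order : ∀ k → 6 ≤ suc (suc (k + k)) → Order (suc (k + suc k))
  even-order (suc (suc (suc (suc k)))) _ = even (4 + k) (s≤s (s≤s (s≤s (s≤s z≤n))))
  even-order 3 _ = eight
  even-order 2 _ = six
  even-order 0 (s≤s (s≤s ()))
  even-order 1 (s≤s (s≤s (s≤s (s≤s ()))))

-- At n = 6 and 8 the general lower bound for B n is too weak, and its weights are computed.
pendantBound<B-weights : ∀ n → 6 ≤ n → pendantBound n < weights (B n)
pendantBound<B-weights n 6≤n with order n 6≤n
... | six        = <ᵇ⇒< (pendantBound 6) (weights (B 6)) _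
... | eight      = <ᵇ⇒< (pendantBound 8) (weights (B 8)) _
... | odd k 3≤k  = <-≤-trans (odd-inequality k 3≤k)
                     (B-weights-lower k k ≤-refl (+-mono-≤ (≤-trans (s≤s (s≤s z≤n)) 3≤k) 3≤k))
... | even k 4≤k = <-≤-trans (even-inequality k 4≤k)
                     (B-weights-lower k (suc k) (n≤1+n k) (+-mono-≤ (≤-trans (s≤s z≤n) 4≤k) (≤-trans 4≤k (n≤1+n k))))

lemma2p1 : (n : ℕ) → 6 ≤ n → (G : Graph n) → Connected G → numEdges G ≡ suc n →
           (∃ λ (v : Fin n) → degree G v ≡ 1) → Sz* G <ℚ Sz* (B n)
lemma2p1 n 6≤n G conn numEdges≡ pendant =
  subst₂ _<ℚ_ (sym (Sz*≡weights/4 G)) (sym (Sz*≡weights/4 (B n))) (/4-mono-< G<B)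
  where
  G<B : weights G < weights (B n)
  G<B = ≤-<-trans (bicyclic-pendant-weights G (≤-trans (s≤s (s≤s z≤n)) 6≤n) conn numEdges≡ pendant)
                   (pendantBound<B-weights n 6≤n)
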